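{- Let $m$ be a fixed positive integer and $t$ a positive integer variable. Then: (i) $(2+x)^t\asymp 2^t(1+x)^t\pmod{x^m}$; (ii) $(2+x)^t(1+x)\asymp(2+x)^t\pmod{x^m}$; (iii) $(1+2^tx)^m(1+x)\asymp(1+2^tx)^m\pmod{x^{m+1}}$; (iv) $R I(S_{2,t})\asymp 1+2^tx(1+x)^t\pmod{x^m}$; (v) $R I(S_{2,t})^3\asymp(1+2^tx)^2+x^3(2+x)^{3t}\pmod{x^m}$; (vi) $R I(T_{3,t})\asymp(1+2^tx)^2+x^2(2+x)^{3t}\pmod{x^m}$; (vii) $R I(T_{3,t})^m(x+1)\asymp\sum_{k=0}^\infty 2^{(k+\lfloor k/2\rfloor)t}x^k\pmod{x^{2m+1}}$; (viii) $R I(S_{2,t})^{3m}\asymp\sum_{k=0}^\infty 2^{kt}x^k\pmod{x^{2m+1}}$.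
   Context: For a simple graph $G$, $I(G)=\sum_k s_kx^k$ is its independence polynomial ($s_k$ = number of independent sets of size $k$). For a polynomial $p$ of degree $n$, the reflected polynomial is $Rp(x)=x^np(1/x)$. $P_n$ is the path on $n$ vertices; $S_{2,t}$ is the tree with a root $w$ to which $t$ copies of $P_2$ are attached (via an endpoint of each copy); $T_{3,t}$ is the tree with a root $v$ having $3$ children, each of which has $t$ pendant copies of $P_2$ attached. Polynomials/power series in $x$ whose coefficients are functions of $t$ are regarded as generating functions. For functions $a,b$ of $t$, $a\in\Theta(b)$ means there are constants $c_1,c_2>0$ and $t_0$ with $c_1b(t)\le a(t)\le c_2b(t)$ for all $t\ge t_0$. For generating functions $\sum_k a_k(t)x^k$, $\sum_k b_k(t)x^k$ with eventually nonnegative coefficients, $\sum_k a_k(t)x^k\asymp\sum_k b_k(t)x^k\pmod{x^M}$ means $a_k(t)\in\Theta(b_k(t))$ for all $0\le k\le M-1$. -}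

module Defs where

open import Data.Nat using (ℕ; zero; suc; _+_; _*_; _∸_; _^_; _≤_; _<_; _≡ᵇ_; _/_; _≤ᵇ_)
open import Data.Bool using (Bool; true; false; not; _∧_; _∨_; if_then_else_)
open import Data.List using (List; []; _∷_; _++_; map; filter; length; concatMap; upTo)
open import Data.Product using (_×_; _,_; ∃-syntax)
open import Relation.Nullary.Decidable using (does)
open import Relation.Unary using (Decidable)
open import Relation.Binary.PropositionalEquality using (_≡_)

Series : Set
Series = ℕ → ℕ

GF : Set
GF = ℕ → Series          -- GF t k = k-th coefficient, as function of t

cst : ℕ → Series
cst c zero    = c
cst c (suc _) = 0

X : Series
X (suc zero) = 1
X _          = 0

infixl 6 _⊕_
infixl 7 _⊛_
infixr 8 _^^_

_⊕_ : Series → Series → Series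
(f ⊕ g) k = f k + g k

sumTo : ℕ → (ℕ → ℕ) → ℕ
sumTo zero    h = h 0
sumTo (suc k) h = sumTo k h + h (suc k)

_⊛_ : Series → Series → Series
(f ⊛ g) k = sumTo k (λ i → f i * g (k ∸ i))

_^^_ : Series → ℕ → Series
f ^^ zero  = cst 1
f ^^ suc n = f ⊛ (f ^^ n)

-- a ∈ Θ(b): constants c₁,c₂ > 0 and t₀ with c₁ b(t) ≤ a(t) ≤ c₂ b(t)
-- for t ≥ t₀.  Over ℕ-valued functions we encode the positive real
-- constant c₁ by its reciprocal bound: b(t) ≤ d₁ a(t) with d₁ ≥ 1
-- (equivalent: take d₁ ≥ 1/c₁, resp. c₁ = 1/d₁).
Θ : (ℕ → ℕ) → (ℕ → ℕ) → Set
Θ a b = ∃[ d₁ ] ∃[ c₂ ] ∃[ t₀ ]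
          (1 ≤ d₁ × 1 ≤ c₂ ×
           (∀ t → t₀ ≤ t → b t ≤ d₁ * a t × a t ≤ c₂ * b t))

_≍_mod_ : GF → GF → ℕ → Set
A ≍ B mod M = ∀ k → k < M → Θ (λ t → A t k) (λ t → B t k)

-- Finite simple graphs on vertex set {0,…,order-1}, given by edge list

record Graph : Set where
  field
    order : ℕ
    edges : List (ℕ × ℕ)
open Graph public

-- all subsets of {0,…,n-1} as characteristic lists of length n
subsets : ℕ → List (List Bool)
subsets zero    = [] ∷ []
subsets (suc n) = map (true ∷_) (subsets n) ++ map (false ∷_) (subsets n)

mem : List Bool → ℕ → Bool
mem []      _       = false
mem (b ∷ _) zero    = b
mem (_ ∷ s) (suc i) = mem s i

size : List Bool → ℕ
size []          = 0
size (true ∷ s)  = suc (size s)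
size (false ∷ s) = size s

allB : {A : Set} → (A → Bool) → List A → Bool
allB p []       = true
allB p (x ∷ xs) = p x ∧ allB p xs

isIndep : Graph → List Bool → Bool
isIndep G S = allB (λ { (u , v) → not (mem S u ∧ mem S v) }) (edges G)

countB : {A : Set} → (A → Bool) → List A → ℕ
countB p []       = 0
countB p (x ∷ xs) = if p x then suc (countB p xs) else countB p xs

indepCount : Graph → ℕ → ℕ
indepCount G k = countB (λ S → isIndep G S ∧ (size S ≡ᵇ k)) (subsets (order G))

I : Graph → Series
I G = indepCount G

-- degree of I(G) (= independence number): largest k ≤ order G with s_k ≠ 0
-- (s_0 = 1, so the search always succeeds)
degFrom : (ℕ → ℕ) → ℕ → ℕ
degFrom s zero    = 0
degFrom s (suc n) = if s (suc n) ≡ᵇ 0 then degFrom s n else suc n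

degI : Graph → ℕ
degI G = degFrom (indepCount G) (order G)

-- reflected polynomial R p (x) = x^n p(1/x), n = deg p
R : ℕ → Series → Series
R n p k = if k ≤ᵇ n then p (n ∸ k) else 0

RI : Graph → Series
RI G = R (degI G) (I G)

-- S_{2,t}: root w = 0; the i-th copy of P_2 (i < t) is 1+2i — 2+2i,
-- attached to the root via its endpoint 1+2i.
S2 : ℕ → Graph
S2 t = record
  { order = 1 + 2 * t
  ; edges = concatMap (λ i → (0 , 1 + 2 * i) ∷ (1 + 2 * i , 2 + 2 * i) ∷ [])
                      (upTo t) }

-- T_{3,t}: root v = 0; children c_j = 1 + j(1+2t) (j < 3); child c_j has
-- t pendant copies of P_2: c_j+1+2i — c_j+2+2i attached via c_j+1+2i.
T3 : ℕ → Graph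
T3 t = record
  { order = 1 + 3 * (1 + 2 * t)
  ; edges = concatMap block (upTo 3) }
  where
  block : ℕ → List (ℕ × ℕ)
  block j = (0 , c) ∷ concatMap (λ i → (c , c + 1 + 2 * i) ∷ (c + 1 + 2 * i , c + 2 + 2 * i) ∷ [])
                                (upTo t)
    where c = 1 + j * (1 + 2 * t)

-- Splitting on whether the vertex a pendant P₂ hangs from is chosen gives
-- I(S₂,ₜ) = x (1 + x)ᵗ + (1 + 2x)ᵗ and I(T₃,ₜ) = x (1 + 2x)³ᵗ + I(S₂,ₜ)³, hence
-- R I(S₂,ₜ) = (1 + x)ᵗ + x (2 + x)ᵗ and R I(T₃,ₜ) = R I(S₂,ₜ)³ + x² (2 + x)³ᵗ.
-- Everything then rests on [xᵏ] (2 + x)ⁿ = C(n, k) 2ⁿ⁻ᵏ: for fixed k and large n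
-- each coefficient is at most twice the next one, and the polynomial factor nᵏ
-- is swallowed by 2ⁿ. For the powers in (vii) and (viii)
-- each coefficient is bounded above through a superadditive exponent φ
-- (2^(φ i t) 2^(φ j t) ≤ 2^(φ (i + j) t)) and below by a single term of the
-- convolution.

module Submission where

open import Defs
open import Data.Nat using (ℕ; zero; suc; _+_; _*_; _∸_; _^_; _≤_; _<_; z≤n; s≤s; _⊔_; _/_; _≡ᵇ_; _≤ᵇ_; NonZero; >-nonZero)
open import Data.Nat.Properties
open import Data.Nat.DivMod using (m/n≡1+[m∸n]/n; /-monoˡ-≤)
open import Data.Nat.Solver using (module +-*-Solver)
open import Data.Bool using (Bool; true; false; not; _∧_; T)
open import Data.Bool.Properties using (∧-zeroʳ)
open import Data.List using (List; []; _∷_; _++_; map; length; concatMap; upTo; applyUpTo)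
open import Data.Product using (_×_; _,_; proj₁; proj₂; Σ-syntax)
open import Data.Sum using (inj₁; inj₂)
open import Data.Empty using (⊥-elim)
open import Data.Unit using (tt)
open import Relation.Binary.PropositionalEquality
open import Relation.Binary.Bundles using (Setoid)
import Relation.Binary.Reasoning.Setoid as SetoidReasoning
open import Relation.Nullary using (¬_)

open +-*-Solver

sumTo-cong : ∀ k {g h : ℕ → ℕ} → (∀ i → i ≤ k → g i ≡ h i) → sumTo k g ≡ sumTo k h
sumTo-cong zero    g≡h = g≡h 0 z≤n
sumTo-cong (suc k) g≡h =
  cong₂ _+_ (sumTo-cong k (λ i i≤k → g≡h i (m≤n⇒m≤1+n i≤k))) (g≡h (suc k) ≤-refl)

sumTo-+ : ∀ k (g h : ℕ → ℕ) → sumTo k (λ i → g i + h i) ≡ sumTo k g + sumTo k h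
sumTo-+ zero    g h = refl
sumTo-+ (suc k) g h = begin
  sumTo k (λ i → g i + h i) + (g (suc k) + h (suc k))
    ≡⟨ cong (_+ (g (suc k) + h (suc k))) (sumTo-+ k g h) ⟩
  sumTo k g + sumTo k h + (g (suc k) + h (suc k))
    ≡⟨ solve 4 (λ a b c d → a :+ b :+ (c :+ d) := a :+ c :+ (b :+ d)) refl
               (sumTo k g) (sumTo k h) (g (suc k)) (h (suc k)) ⟩
  sumTo k g + g (suc k) + (sumTo k h + h (suc k)) ∎
  where open ≡-Reasoning

sumTo-*ˡ : ∀ k c (h : ℕ → ℕ) → sumTo k (λ i → c * h i) ≡ c * sumTo k h
sumTo-*ˡ zero    c h = refl
sumTo-*ˡ (suc k) c h =
  trans (cong (_+ c * h (suc k)) (sumTo-*ˡ k c h)) (sym (*-distribˡ-+ c (sumTo k h) _))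

sumTo-suc : ∀ k (h : ℕ → ℕ) → sumTo (suc k) h ≡ h 0 + sumTo k (λ i → h (suc i))
sumTo-suc zero    h = refl
sumTo-suc (suc k) h = trans (cong (_+ h (suc (suc k))) (sumTo-suc k h)) (+-assoc (h 0) _ _)

sumTo-zero : ∀ k {h : ℕ → ℕ} → (∀ i → i ≤ k → h i ≡ 0) → sumTo k h ≡ 0
sumTo-zero zero    h≡0 = h≡0 0 z≤n
sumTo-zero (suc k) h≡0 =
  cong₂ _+_ (sumTo-zero k (λ i i≤k → h≡0 i (m≤n⇒m≤1+n i≤k))) (h≡0 (suc k) ≤-refl)

sumTo-reverse : ∀ k (h : ℕ → ℕ) → sumTo k h ≡ sumTo k (λ i → h (k ∸ i))
sumTo-reverse zero    h = refl
sumTo-reverse (suc k) h = begin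
  sumTo k h + h (suc k)                  ≡⟨ cong (_+ h (suc k)) (sumTo-reverse k h) ⟩
  sumTo k (λ i → h (k ∸ i)) + h (suc k)  ≡⟨ +-comm _ (h (suc k)) ⟩
  h (suc k) + sumTo k (λ i → h (k ∸ i))  ≡⟨ sumTo-suc k (λ i → h (suc k ∸ i)) ⟨
  sumTo (suc k) (λ i → h (suc k ∸ i))    ∎
  where open ≡-Reasoning

≤-sumTo : ∀ k (h : ℕ → ℕ) {j} → j ≤ k → h j ≤ sumTo k h
≤-sumTo zero    h z≤n = ≤-refl
≤-sumTo (suc k) h j≤1+k with m≤n⇒m<n∨m≡n j≤1+k
... | inj₁ j<1+k = ≤-trans (≤-sumTo k h (≤-pred j<1+k)) (m≤m+n _ _)
... | inj₂ refl  = m≤n+m _ _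

-- The semiring of series

module ≗-Reasoning = SetoidReasoning (ℕ →-setoid ℕ)

open Setoid (ℕ →-setoid ℕ)
  using () renaming (refl to ≗-refl; sym to ≗-sym; trans to ≗-trans)

shift : Series → Series
shift f zero    = 0
shift f (suc k) = f k

tail : Series → Series
tail f k = f (suc k)

scale : ℕ → Series → Series
scale c f k = c * f k

shift-cong : ∀ {f g} → f ≗ g → shift f ≗ shift g
shift-cong f≗g zero    = refl
shift-cong f≗g (suc k) = f≗g k

⊕-cong : ∀ {f f′ g g′} → f ≗ f′ → g ≗ g′ → f ⊕ g ≗ f′ ⊕ g′
⊕-cong f≗f′ g≗g′ k = cong₂ _+_ (f≗f′ k) (g≗g′ k)

⊛-congˡ : ∀ {f f′} g → f ≗ f′ → f ⊛ g ≗ f′ ⊛ g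
⊛-congˡ g f≗f′ k = sumTo-cong k (λ i _ → cong (_* g (k ∸ i)) (f≗f′ i))

⊛-congʳ : ∀ f {g g′} → g ≗ g′ → f ⊛ g ≗ f ⊛ g′
⊛-congʳ f g≗g′ k = sumTo-cong k (λ i _ → cong (f i *_) (g≗g′ (k ∸ i)))

⊛-cong : ∀ {f f′ g g′} → f ≗ f′ → g ≗ g′ → f ⊛ g ≗ f′ ⊛ g′
⊛-cong {f′ = f′} {g} f≗f′ g≗g′ = ≗-trans (⊛-congˡ g f≗f′) (⊛-congʳ f′ g≗g′)

^^-cong : ∀ {f g} n → f ≗ g → f ^^ n ≗ g ^^ n
^^-cong zero    f≗g = ≗-refl
^^-cong (suc n) f≗g = ⊛-cong f≗g (^^-cong n f≗g)

⊛-split : ∀ f g → f ⊛ g ≗ scale (f 0) g ⊕ shift (tail f ⊛ g)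
⊛-split f g zero    = sym (+-identityʳ _)
⊛-split f g (suc k) = sumTo-suc k (λ i → f i * g (suc k ∸ i))

cst-⊛ : ∀ c g → cst c ⊛ g ≗ scale c g
cst-⊛ c g zero    = refl
cst-⊛ c g (suc k) = begin
  sumTo (suc k) (λ i → cst c i * g (suc k ∸ i)) ≡⟨ sumTo-suc k _ ⟩
  c * g (suc k) + sumTo k (λ _ → 0)            ≡⟨ cong (c * g (suc k) +_) (sumTo-zero k (λ _ _ → refl)) ⟩
  c * g (suc k) + 0                            ≡⟨ +-identityʳ _ ⟩
  c * g (suc k)                                ∎
  where open ≡-Reasoning

shift-⊛ : ∀ f g → shift f ⊛ g ≗ shift (f ⊛ g)
shift-⊛ f g zero    = refl
shift-⊛ f g (suc k) = sumTo-suc k _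

scale-⊛ : ∀ c f g → scale c f ⊛ g ≗ scale c (f ⊛ g)
scale-⊛ c f g k = trans (sumTo-cong k (λ i _ → *-assoc c (f i) _)) (sumTo-*ˡ k c _)

⊛-distribʳ-⊕ : ∀ h f g → (f ⊕ g) ⊛ h ≗ f ⊛ h ⊕ g ⊛ h
⊛-distribʳ-⊕ h f g k =
  trans (sumTo-cong k (λ i _ → *-distribʳ-+ (h (k ∸ i)) (f i) (g i))) (sumTo-+ k _ _)

⊛-distribˡ-⊕ : ∀ h f g → h ⊛ (f ⊕ g) ≗ h ⊛ f ⊕ h ⊛ g
⊛-distribˡ-⊕ h f g k =
  trans (sumTo-cong k (λ i _ → *-distribˡ-+ (h i) (f (k ∸ i)) (g (k ∸ i)))) (sumTo-+ k _ _)

⊛-comm : ∀ f g → f ⊛ g ≗ g ⊛ f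
⊛-comm f g k = trans (sumTo-reverse k _) (sumTo-cong k reindex)
  where
  reindex : ∀ i → i ≤ k → f (k ∸ i) * g (k ∸ (k ∸ i)) ≡ g i * f (k ∸ i)
  reindex i i≤k = trans (cong (λ j → f (k ∸ i) * g j) (m∸[m∸n]≡n i≤k)) (*-comm (f (k ∸ i)) (g i))

⊛-assoc : ∀ f g h → (f ⊛ g) ⊛ h ≗ f ⊛ (g ⊛ h)
⊛-assoc f g h zero    = *-assoc (f 0) (g 0) (h 0)
⊛-assoc f g h (suc k) = begin
  ((f ⊛ g) ⊛ h) (suc k)
    ≡⟨ ⊛-congˡ h (⊛-split f g) (suc k) ⟩
  ((scale (f 0) g ⊕ shift (tail f ⊛ g)) ⊛ h) (suc k)
    ≡⟨ ⊛-distribʳ-⊕ h (scale (f 0) g) (shift (tail f ⊛ g)) (suc k) ⟩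
  (scale (f 0) g ⊛ h) (suc k) + (shift (tail f ⊛ g) ⊛ h) (suc k)
    ≡⟨ cong₂ _+_ (scale-⊛ (f 0) g h (suc k)) (shift-⊛ (tail f ⊛ g) h (suc k)) ⟩
  f 0 * (g ⊛ h) (suc k) + ((tail f ⊛ g) ⊛ h) k
    ≡⟨ cong (f 0 * (g ⊛ h) (suc k) +_) (⊛-assoc (tail f) g h k) ⟩
  f 0 * (g ⊛ h) (suc k) + (tail f ⊛ (g ⊛ h)) k
    ≡⟨ ⊛-split f (g ⊛ h) (suc k) ⟨
  (f ⊛ (g ⊛ h)) (suc k) ∎
  where open ≡-Reasoning

⊛-identityˡ : ∀ g → cst 1 ⊛ g ≗ g
⊛-identityˡ g k = trans (cst-⊛ 1 g k) (*-identityˡ (g k))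

X≗shift-1 : X ≗ shift (cst 1)
X≗shift-1 zero          = refl
X≗shift-1 (suc zero)    = refl
X≗shift-1 (suc (suc k)) = refl

X-⊛ : ∀ g → X ⊛ g ≗ shift g
X-⊛ g = begin
  X ⊛ g                ≈⟨ ⊛-congˡ g X≗shift-1 ⟩
  shift (cst 1) ⊛ g    ≈⟨ shift-⊛ (cst 1) g ⟩
  shift (cst 1 ⊛ g)    ≈⟨ shift-cong (⊛-identityˡ g) ⟩
  shift g              ∎
  where open ≗-Reasoning

⊛-identityʳ : ∀ g → g ⊛ cst 1 ≗ g
⊛-identityʳ g = ≗-trans (⊛-comm g (cst 1)) (⊛-identityˡ g)

⊛-shiftʳ : ∀ f g → f ⊛ shift g ≗ shift (f ⊛ g)
⊛-shiftʳ f g = ≗-trans (⊛-comm f (shift g)) (≗-trans (shift-⊛ g f) (shift-cong (⊛-comm g f)))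

^^-distribˡ-+-⊛ : ∀ f m n → f ^^ (m + n) ≗ f ^^ m ⊛ f ^^ n
^^-distribˡ-+-⊛ f zero    n = ≗-sym (⊛-identityˡ (f ^^ n))
^^-distribˡ-+-⊛ f (suc m) n =
  ≗-trans (⊛-congʳ f (^^-distribˡ-+-⊛ f m n)) (≗-sym (⊛-assoc f (f ^^ m) (f ^^ n)))

shift-⊕ : ∀ f g → shift f ⊕ shift g ≗ shift (f ⊕ g)
shift-⊕ f g zero    = refl
shift-⊕ f g (suc k) = refl

shift-scale : ∀ c f → shift (scale c f) ≗ scale c (shift f)
shift-scale c f zero    = sym (*-zeroʳ c)
shift-scale c f (suc k) = refl

shiftN : ℕ → Series → Series
shiftN zero    f = f
shiftN (suc n) f = shift (shiftN n f)

X^^-⊛ : ∀ n g → X ^^ n ⊛ g ≗ shiftN n g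
X^^-⊛ zero    g = ⊛-identityˡ g
X^^-⊛ (suc n) g = begin
  (X ⊛ X ^^ n) ⊛ g    ≈⟨ ⊛-assoc X (X ^^ n) g ⟩
  X ⊛ (X ^^ n ⊛ g)    ≈⟨ X-⊛ (X ^^ n ⊛ g) ⟩
  shift (X ^^ n ⊛ g)  ≈⟨ shift-cong (X^^-⊛ n g) ⟩
  shiftN (suc n) g    ∎
  where open ≗-Reasoning

cst-X-⊛ : ∀ c g → cst c ⊛ X ⊛ g ≗ shift (scale c g)
cst-X-⊛ c g = begin
  (cst c ⊛ X) ⊛ g      ≈⟨ ⊛-assoc (cst c) X g ⟩
  cst c ⊛ (X ⊛ g)      ≈⟨ ⊛-congʳ (cst c) (X-⊛ g) ⟩
  cst c ⊛ shift g      ≈⟨ cst-⊛ c (shift g) ⟩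
  scale c (shift g)    ≈⟨ shift-scale c g ⟨
  shift (scale c g)    ∎
  where open ≗-Reasoning

-- Powers of a linear polynomial

linMul : ℕ → ℕ → Series → Series
linMul a b f zero    = a * f 0
linMul a b f (suc k) = a * f (suc k) + b * f k

linPow : ℕ → ℕ → ℕ → Series
linPow a b zero    = cst 1
linPow a b (suc n) = linMul a b (linPow a b n)

binomial : ℕ → Series
binomial = linPow 1 1

lin-⊛ : ∀ a b f → (cst a ⊕ cst b ⊛ X) ⊛ f ≗ linMul a b f
lin-⊛ a b f = begin
  (cst a ⊕ cst b ⊛ X) ⊛ f          ≈⟨ ⊛-distribʳ-⊕ f (cst a) (cst b ⊛ X) ⟩
  cst a ⊛ f ⊕ (cst b ⊛ X) ⊛ f      ≈⟨ ⊕-cong (cst-⊛ a f) (⊛-assoc (cst b) X f) ⟩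
  scale a f ⊕ cst b ⊛ (X ⊛ f)      ≈⟨ ⊕-cong ≗-refl (⊛-congʳ (cst b) (X-⊛ f)) ⟩
  scale a f ⊕ cst b ⊛ shift f      ≈⟨ ⊕-cong ≗-refl (cst-⊛ b (shift f)) ⟩
  scale a f ⊕ scale b (shift f)    ≈⟨ collect ⟩
  linMul a b f                     ∎
  where
  open ≗-Reasoning
  collect : scale a f ⊕ scale b (shift f) ≗ linMul a b f
  collect zero    = trans (cong (a * f 0 +_) (*-zeroʳ b)) (+-identityʳ _)
  collect (suc k) = refl

lin-^^ : ∀ a b n → (cst a ⊕ cst b ⊛ X) ^^ n ≗ linPow a b n
lin-^^ a b zero    = ≗-refl
lin-^^ a b (suc n) =
  ≗-trans (⊛-congʳ (cst a ⊕ cst b ⊛ X) (lin-^^ a b n)) (lin-⊛ a b (linPow a b n))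

monic-lin : ∀ a → cst a ⊕ X ≗ cst a ⊕ cst 1 ⊛ X
monic-lin a = ⊕-cong {cst a} ≗-refl (≗-sym (⊛-identityˡ X))

monic-lin-^^ : ∀ a n → (cst a ⊕ X) ^^ n ≗ linPow a 1 n
monic-lin-^^ a n = ≗-trans (^^-cong n (monic-lin a)) (lin-^^ a 1 n)

⊛-1+x : ∀ f → f ⊛ (cst 1 ⊕ X) ≗ linMul 1 1 f
⊛-1+x f = begin
  f ⊛ (cst 1 ⊕ X)            ≈⟨ ⊛-comm f (cst 1 ⊕ X) ⟩
  (cst 1 ⊕ X) ⊛ f            ≈⟨ ⊛-congˡ f (monic-lin 1) ⟩
  (cst 1 ⊕ cst 1 ⊛ X) ⊛ f    ≈⟨ lin-⊛ 1 1 f ⟩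
  linMul 1 1 f               ∎
  where open ≗-Reasoning

linPow-+ : ∀ a b m n → linPow a b m ⊛ linPow a b n ≗ linPow a b (m + n)
linPow-+ a b m n = begin
  linPow a b m ⊛ linPow a b n  ≈⟨ ⊛-cong (lin-^^ a b m) (lin-^^ a b n) ⟨
  L ^^ m ⊛ L ^^ n              ≈⟨ ^^-distribˡ-+-⊛ L m n ⟨
  L ^^ (m + n)                 ≈⟨ lin-^^ a b (m + n) ⟩
  linPow a b (m + n)           ∎
  where
  open ≗-Reasoning
  L = cst a ⊕ cst b ⊛ X

linPow-vanish : ∀ a b n {k} → n < k → linPow a b n k ≡ 0
linPow-vanish a b zero    {suc k} _         = refl
linPow-vanish a b (suc n) {suc k} (s≤s n<k) = begin
  a * linPow a b n (suc k) + b * linPow a b n k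
    ≡⟨ cong₂ (λ u v → a * u + b * v) (linPow-vanish a b n (m<n⇒m<1+n n<k)) (linPow-vanish a b n n<k) ⟩
  a * 0 + b * 0
    ≡⟨ cong₂ _+_ (*-zeroʳ a) (*-zeroʳ b) ⟩
  0 ∎
  where open ≡-Reasoning

linPow-constant : ∀ a b n → linPow a b n 0 ≡ a ^ n
linPow-constant a b zero    = refl
linPow-constant a b (suc n) = cong (a *_) (linPow-constant a b n)

-- x ^ n (a + b / x) ^ n = (b + a x) ^ n
linPow-swap : ∀ a b n i j → i + j ≡ n → linPow a b n i ≡ linPow b a n j
linPow-swap a b zero    zero    zero    _    = refl
linPow-swap a b (suc n) zero    (suc j) refl = begin
  a * linPow a b j 0                             ≡⟨ cong (a *_) (linPow-swap a b j 0 j refl) ⟩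
  a * linPow b a j j                             ≡⟨ +-identityˡ _ ⟨
  0 + a * linPow b a j j                         ≡⟨ cong (λ z → z + a * linPow b a j j) (*-zeroʳ b) ⟨
  b * 0 + a * linPow b a j j                     ≡⟨ cong (λ z → b * z + a * linPow b a j j) (linPow-vanish b a j ≤-refl) ⟨
  b * linPow b a j (suc j) + a * linPow b a j j  ∎
  where open ≡-Reasoning
linPow-swap a b (suc n) (suc i) zero    eq with trans (sym (+-identityʳ (suc i))) eq
... | refl = begin
  a * linPow a b i (suc i) + b * linPow a b i i  ≡⟨ cong (λ z → a * z + b * linPow a b i i) (linPow-vanish a b i ≤-refl) ⟩
  a * 0 + b * linPow a b i i                     ≡⟨ cong (_+ b * linPow a b i i) (*-zeroʳ a) ⟩
  b * linPow a b i i                             ≡⟨ cong (b *_) (linPow-swap a b i i 0 (+-identityʳ i)) ⟩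
  b * linPow b a i 0                             ∎
  where open ≡-Reasoning
linPow-swap a b (suc n) (suc i) (suc j) eq = begin
  a * linPow a b n (suc i) + b * linPow a b n i
    ≡⟨ cong₂ (λ u v → a * u + b * v)
             (linPow-swap a b n (suc i) j (trans (sym (+-suc i j)) (suc-injective eq)))
             (linPow-swap a b n i (suc j) (suc-injective eq)) ⟩
  a * linPow b a n j + b * linPow b a n (suc j)
    ≡⟨ +-comm (a * linPow b a n j) _ ⟩
  b * linPow b a n (suc j) + a * linPow b a n j ∎
  where open ≡-Reasoning

linPow-scale : ∀ r n k → linPow 1 r n k ≡ binomial n k * r ^ k
linPow-scale r zero    zero    = refl
linPow-scale r zero    (suc k) = refl
linPow-scale r (suc n) zero    = begin
  1 * linPow 1 r n 0         ≡⟨ cong (1 *_) (linPow-scale r n 0) ⟩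
  1 * (binomial n 0 * 1)     ≡⟨ solve 1 (λ x → con 1 :* (x :* con 1) := (con 1 :* x) :* con 1) refl (binomial n 0) ⟩
  (1 * binomial n 0) * 1     ∎
  where open ≡-Reasoning
linPow-scale r (suc n) (suc k) = begin
  1 * linPow 1 r n (suc k) + r * linPow 1 r n k
    ≡⟨ cong₂ (λ u v → 1 * u + r * v) (linPow-scale r n (suc k)) (linPow-scale r n k) ⟩
  1 * (binomial n (suc k) * (r * r ^ k)) + r * (binomial n k * r ^ k)
    ≡⟨ solve 4 (λ x y r q → con 1 :* (x :* (r :* q)) :+ r :* (y :* q) := (con 1 :* x :+ con 1 :* y) :* (r :* q))
             refl (binomial n (suc k)) (binomial n k) r (r ^ k) ⟩
  (1 * binomial n (suc k) + 1 * binomial n k) * (r * r ^ k) ∎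
  where open ≡-Reasoning

-- (k + 1) C(n, k + 1) = (n - k) C(n, k), with the subtraction moved to the left
binomial-absorption : ∀ n k → suc k * binomial n (suc k) + k * binomial n k ≡ n * binomial n k
binomial-absorption zero    zero    = refl
binomial-absorption zero    (suc k) = cong₂ _+_ (*-zeroʳ (suc (suc k))) (*-zeroʳ (suc k))
binomial-absorption (suc n) zero    = begin
  1 * (1 * b₁ + 1 * b₀) + 0  ≡⟨ solve 2 (λ x y → con 1 :* (con 1 :* x :+ con 1 :* y) :+ con 0
                                             := (con 1 :* x :+ con 0 :* y) :+ y) refl b₁ b₀ ⟩
  (1 * b₁ + 0 * b₀) + b₀     ≡⟨ cong (_+ b₀) (binomial-absorption n 0) ⟩
  n * b₀ + b₀                ≡⟨ solve 2 (λ n y → n :* y :+ y := (con 1 :+ n) :* (con 1 :* y)) refl n b₀ ⟩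
  suc n * (1 * b₀)           ∎
  where
  open ≡-Reasoning
  b₁ = binomial n 1
  b₀ = binomial n 0
binomial-absorption (suc n) (suc k) = begin
  suc (suc k) * (1 * b₂ + 1 * b₁) + suc k * (1 * b₁ + 1 * b₀)
    ≡⟨ solve 4 (λ k b₂ b₁ b₀ → (con 2 :+ k) :* (con 1 :* b₂ :+ con 1 :* b₁) :+ (con 1 :+ k) :* (con 1 :* b₁ :+ con 1 :* b₀)
                            := ((con 2 :+ k) :* b₂ :+ (con 1 :+ k) :* b₁) :+ b₁ :+ ((con 1 :+ k) :* b₁ :+ k :* b₀) :+ b₀)
             refl k b₂ b₁ b₀ ⟩
  (suc (suc k) * b₂ + suc k * b₁) + b₁ + (suc k * b₁ + k * b₀) + b₀
    ≡⟨ cong₂ (λ u v → u + b₁ + v + b₀) (binomial-absorption n (suc k)) (binomial-absorption n k) ⟩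
  n * b₁ + b₁ + n * b₀ + b₀
    ≡⟨ solve 3 (λ n b₁ b₀ → n :* b₁ :+ b₁ :+ n :* b₀ :+ b₀ := (con 1 :+ n) :* (con 1 :* b₁ :+ con 1 :* b₀)) refl n b₁ b₀ ⟩
  suc n * (1 * b₁ + 1 * b₀) ∎
  where
  open ≡-Reasoning
  b₂ = binomial n (suc (suc k))
  b₁ = binomial n (suc k)
  b₀ = binomial n k

binomial-pos : ∀ n k → k ≤ n → 1 ≤ binomial n k
binomial-pos zero    zero    _         = ≤-refl
binomial-pos (suc n) zero    _         = ≤-trans (binomial-pos n 0 z≤n) (≤-reflexive (sym (*-identityˡ _)))
binomial-pos (suc n) (suc k) (s≤s k≤n) =
  ≤-trans (≤-trans (binomial-pos n k k≤n) (≤-reflexive (sym (*-identityˡ _)))) (m≤n+m _ (1 * binomial n (suc k)))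

binomial-suc≤ : ∀ n j → binomial n (suc j) ≤ n * binomial n j
binomial-suc≤ n j = begin
  binomial n (suc j)                            ≤⟨ m≤n*m _ (suc j) ⟩
  suc j * binomial n (suc j)                    ≤⟨ m≤m+n _ _ ⟩
  suc j * binomial n (suc j) + j * binomial n j ≡⟨ binomial-absorption n j ⟩
  n * binomial n j                              ∎
  where open ≤-Reasoning

binomial-mono : ∀ n j → suc (2 * j) ≤ n → binomial n j ≤ binomial n (suc j)
binomial-mono n j 2j<n = *-cancelˡ-≤ (suc j) (+-cancelʳ-≤ (j * binomial n j) _ _ (begin
  suc j * binomial n j + j * binomial n j
    ≡⟨ solve 2 (λ j b → (con 1 :+ j) :* b :+ j :* b := (con 1 :+ (j :+ (j :+ con 0))) :* b) refl j (binomial n j) ⟩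
  suc (2 * j) * binomial n j                      ≤⟨ *-monoˡ-≤ (binomial n j) 2j<n ⟩
  n * binomial n j                                ≡⟨ binomial-absorption n j ⟨
  suc j * binomial n (suc j) + j * binomial n j   ∎))
  where open ≤-Reasoning

linPow-binomial : ∀ a n k → a ^ k * linPow a 1 n k ≡ a ^ n * binomial n k
linPow-binomial a zero    zero    = refl
linPow-binomial a zero    (suc k) = *-zeroʳ (a ^ suc k)
linPow-binomial a (suc n) zero    = begin
  1 * (a * linPow a 1 n 0)        ≡⟨ solve 2 (λ a e → con 1 :* (a :* e) := a :* (con 1 :* e)) refl a (linPow a 1 n 0) ⟩
  a * (1 * linPow a 1 n 0)        ≡⟨ cong (a *_) (linPow-binomial a n 0) ⟩
  a * (a ^ n * binomial n 0)      ≡⟨ solve 3 (λ a p b → a :* (p :* b) := (a :* p) :* (con 1 :* b)) refl a (a ^ n) (binomial n 0) ⟩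
  (a * a ^ n) * (1 * binomial n 0) ∎
  where open ≡-Reasoning
linPow-binomial a (suc n) (suc k) = begin
  (a * a ^ k) * (a * linPow a 1 n (suc k) + 1 * linPow a 1 n k)
    ≡⟨ solve 4 (λ a p x y → (a :* p) :* (a :* x :+ con 1 :* y) := a :* ((a :* p) :* x) :+ a :* (p :* y))
             refl a (a ^ k) (linPow a 1 n (suc k)) (linPow a 1 n k) ⟩
  a * (a ^ suc k * linPow a 1 n (suc k)) + a * (a ^ k * linPow a 1 n k)
    ≡⟨ cong₂ (λ u v → a * u + a * v) (linPow-binomial a n (suc k)) (linPow-binomial a n k) ⟩
  a * (a ^ n * binomial n (suc k)) + a * (a ^ n * binomial n k)
    ≡⟨ solve 4 (λ a p x y → a :* (p :* x) :+ a :* (p :* y) := (a :* p) :* (con 1 :* x :+ con 1 :* y))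
             refl a (a ^ n) (binomial n (suc k)) (binomial n k) ⟩
  (a * a ^ n) * (1 * binomial n (suc k) + 1 * binomial n k) ∎
  where open ≡-Reasoning

module _ (a : ℕ) .{{_ : NonZero a}} where

  private
    cancel-^ : ∀ j {x y} → a ^ j * x ≤ a ^ j * y → x ≤ y
    cancel-^ j = *-cancelˡ-≤ (a ^ j) {{m^n≢0 a j}}

  linPow-suc≤ : ∀ n j → linPow a 1 n (suc j) ≤ n * linPow a 1 n j
  linPow-suc≤ n j = ≤-trans (m≤n*m _ a) (cancel-^ j (begin
    a ^ j * (a * linPow a 1 n (suc j))  ≡⟨ solve 3 (λ a p e → p :* (a :* e) := (a :* p) :* e) refl a (a ^ j) (linPow a 1 n (suc j)) ⟩
    a ^ suc j * linPow a 1 n (suc j)    ≡⟨ linPow-binomial a n (suc j) ⟩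
    a ^ n * binomial n (suc j)          ≤⟨ *-monoʳ-≤ (a ^ n) (binomial-suc≤ n j) ⟩
    a ^ n * (n * binomial n j)          ≡⟨ solve 3 (λ p n b → p :* (n :* b) := n :* (p :* b)) refl (a ^ n) n (binomial n j) ⟩
    n * (a ^ n * binomial n j)          ≡⟨ cong (n *_) (linPow-binomial a n j) ⟨
    n * (a ^ j * linPow a 1 n j)        ≡⟨ solve 3 (λ p n e → n :* (p :* e) := p :* (n :* e)) refl (a ^ j) n (linPow a 1 n j) ⟩
    a ^ j * (n * linPow a 1 n j)        ∎))
    where open ≤-Reasoning

  linPow-mono : ∀ n j → suc (2 * j) ≤ n → linPow a 1 n j ≤ a * linPow a 1 n (suc j)
  linPow-mono n j 2j<n = cancel-^ (suc j) (begin
    a ^ suc j * linPow a 1 n j            ≡⟨ *-assoc a (a ^ j) _ ⟩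
    a * (a ^ j * linPow a 1 n j)          ≡⟨ cong (a *_) (linPow-binomial a n j) ⟩
    a * (a ^ n * binomial n j)            ≤⟨ *-monoʳ-≤ a (*-monoʳ-≤ (a ^ n) (binomial-mono n j 2j<n)) ⟩
    a * (a ^ n * binomial n (suc j))      ≡⟨ cong (a *_) (linPow-binomial a n (suc j)) ⟨
    a * (a ^ suc j * linPow a 1 n (suc j)) ≡⟨ solve 3 (λ a p e → a :* (p :* e) := p :* (a :* e)) refl a (a ^ suc j) (linPow a 1 n (suc j)) ⟩
    a ^ suc j * (a * linPow a 1 n (suc j)) ∎)
    where open ≤-Reasoning

  linPow≤ : ∀ n i → linPow a 1 n i ≤ n ^ i * a ^ n
  linPow≤ n zero    = ≤-reflexive (trans (linPow-constant a 1 n) (sym (*-identityˡ _)))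
  linPow≤ n (suc i) = begin
    linPow a 1 n (suc i)     ≤⟨ linPow-suc≤ n i ⟩
    n * linPow a 1 n i       ≤⟨ *-monoʳ-≤ n (linPow≤ n i) ⟩
    n * (n ^ i * a ^ n)      ≡⟨ *-assoc n (n ^ i) (a ^ n) ⟨
    n ^ suc i * a ^ n        ∎
    where open ≤-Reasoning

linPow-^^ : ∀ a b m n → linPow a b m ^^ n ≗ linPow a b (n * m)
linPow-^^ a b m zero    = ≗-refl
linPow-^^ a b m (suc n) =
  ≗-trans (⊛-congʳ (linPow a b m) (linPow-^^ a b m n)) (linPow-+ a b m (n * m))

linPow-1-^^ : ∀ a b n → linPow a b 1 ^^ n ≗ linPow a b n
linPow-1-^^ a b n k = trans (linPow-^^ a b 1 n k) (cong (λ m → linPow a b m k) (*-identityʳ n))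

shift-⊕-linMul : ∀ f → shift f ⊕ f ≗ linMul 1 1 f
shift-⊕-linMul f zero    = sym (*-identityˡ (f 0))
shift-⊕-linMul f (suc k) = trans (+-comm (f k) (f (suc k))) (sym (cong₂ _+_ (*-identityˡ (f (suc k))) (*-identityˡ (f k))))

-- Eventual domination up to a constant factor

infix 4 _≲_ _≋_

_≲_ : (ℕ → ℕ) → (ℕ → ℕ) → Set
a ≲ b = Σ[ c ∈ ℕ ] Σ[ t₀ ∈ ℕ ] (∀ t → t₀ ≤ t → a t ≤ c * b t)

_≋_ : (ℕ → ℕ) → (ℕ → ℕ) → Set
a ≋ b = a ≲ b × b ≲ a

≤⇒≲ : ∀ {a b} → (∀ t → a t ≤ b t) → a ≲ b
≤⇒≲ {b = b} a≤b = 1 , 0 , λ t _ → ≤-trans (a≤b t) (≤-reflexive (sym (*-identityˡ (b t))))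

≲-refl : ∀ {a} → a ≲ a
≲-refl = ≤⇒≲ (λ t → ≤-refl)

≲-trans : ∀ {a b c} → a ≲ b → b ≲ c → a ≲ c
≲-trans {a} {b} {c} (k , s , a≤kb) (l , u , b≤lc) = k * l , s ⊔ u , λ t t≥ → begin
  a t              ≤⟨ a≤kb t (≤-trans (m≤m⊔n s u) t≥) ⟩
  k * b t          ≤⟨ *-monoʳ-≤ k (b≤lc t (≤-trans (m≤n⊔m s u) t≥)) ⟩
  k * (l * c t)    ≡⟨ *-assoc k l (c t) ⟨
  k * l * c t      ∎
  where open ≤-Reasoning

≲-+ : ∀ {a a′ b b′} → a ≲ b → a′ ≲ b′ → (λ t → a t + a′ t) ≲ (λ t → b t + b′ t)
≲-+ {a} {a′} {b} {b′} (k , s , a≤kb) (l , u , a′≤lb′) = k + l , s ⊔ u , λ t t≥ → begin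
  a t + a′ t                  ≤⟨ +-mono-≤ (a≤kb t (≤-trans (m≤m⊔n s u) t≥)) (a′≤lb′ t (≤-trans (m≤n⊔m s u) t≥)) ⟩
  k * b t + l * b′ t          ≤⟨ +-mono-≤ (*-monoˡ-≤ (b t) (m≤m+n k l)) (*-monoˡ-≤ (b′ t) (m≤n+m l k)) ⟩
  (k + l) * b t + (k + l) * b′ t ≡⟨ *-distribˡ-+ (k + l) (b t) (b′ t) ⟨
  (k + l) * (b t + b′ t)      ∎
  where open ≤-Reasoning

≲-* : ∀ {a a′ b b′} → a ≲ b → a′ ≲ b′ → (λ t → a t * a′ t) ≲ (λ t → b t * b′ t)
≲-* {a} {a′} {b} {b′} (k , s , a≤kb) (l , u , a′≤lb′) = k * l , s ⊔ u , λ t t≥ → begin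
  a t * a′ t              ≤⟨ *-mono-≤ (a≤kb t (≤-trans (m≤m⊔n s u) t≥)) (a′≤lb′ t (≤-trans (m≤n⊔m s u) t≥)) ⟩
  (k * b t) * (l * b′ t)  ≡⟨ solve 4 (λ k x l y → (k :* x) :* (l :* y) := (k :* l) :* (x :* y)) refl k (b t) l (b′ t) ⟩
  (k * l) * (b t * b′ t)  ∎
  where open ≤-Reasoning

≲-lub : ∀ {a a′ b} → a ≲ b → a′ ≲ b → (λ t → a t + a′ t) ≲ b
≲-lub {b = b} a≲b a′≲b = ≲-trans (≲-+ a≲b a′≲b) (2 , 0 , λ t _ → ≤-reflexive (cong (b t +_) (sym (+-identityʳ (b t)))))

≲-sumTo : ∀ k {g h : ℕ → ℕ → ℕ} → (∀ i → i ≤ k → (λ t → g t i) ≲ (λ t → h t i)) →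
          (λ t → sumTo k (g t)) ≲ (λ t → sumTo k (h t))
≲-sumTo zero    g≲h = g≲h 0 z≤n
≲-sumTo (suc k) g≲h = ≲-+ (≲-sumTo k (λ i i≤k → g≲h i (m≤n⇒m≤1+n i≤k))) (g≲h (suc k) ≤-refl)

≲-sumTo-lub : ∀ k {g : ℕ → ℕ → ℕ} {b : ℕ → ℕ} → (∀ i → i ≤ k → (λ t → g t i) ≲ b) →
              (λ t → sumTo k (g t)) ≲ b
≲-sumTo-lub zero    g≲b = g≲b 0 z≤n
≲-sumTo-lub (suc k) g≲b = ≲-lub (≲-sumTo-lub k (λ i i≤k → g≲b i (m≤n⇒m≤1+n i≤k))) (g≲b (suc k) ≤-refl)

≋-refl : ∀ {a} → a ≋ a
≋-refl = ≲-refl , ≲-refl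

≋-sym : ∀ {a b} → a ≋ b → b ≋ a
≋-sym (a≲b , b≲a) = b≲a , a≲b

≋-trans : ∀ {a b c} → a ≋ b → b ≋ c → a ≋ c
≋-trans (a≲b , b≲a) (b≲c , c≲b) = ≲-trans a≲b b≲c , ≲-trans c≲b b≲a

≗⇒≋ : ∀ {a b} → a ≗ b → a ≋ b
≗⇒≋ a≗b = ≤⇒≲ (λ t → ≤-reflexive (a≗b t)) , ≤⇒≲ (λ t → ≤-reflexive (sym (a≗b t)))

≋-+ : ∀ {a a′ b b′} → a ≋ b → a′ ≋ b′ → (λ t → a t + a′ t) ≋ (λ t → b t + b′ t)
≋-+ (a≲b , b≲a) (a′≲b′ , b′≲a′) = ≲-+ a≲b a′≲b′ , ≲-+ b≲a b′≲a′

≋-* : ∀ {a a′ b b′} → a ≋ b → a′ ≋ b′ → (λ t → a t * a′ t) ≋ (λ t → b t * b′ t)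
≋-* (a≲b , b≲a) (a′≲b′ , b′≲a′) = ≲-* a≲b a′≲b′ , ≲-* b≲a b′≲a′

≋-sumTo : ∀ k {g h : ℕ → ℕ → ℕ} → (∀ i → i ≤ k → (λ t → g t i) ≋ (λ t → h t i)) →
          (λ t → sumTo k (g t)) ≋ (λ t → sumTo k (h t))
≋-sumTo k g≋h = ≲-sumTo k (λ i i≤k → proj₁ (g≋h i i≤k)) , ≲-sumTo k (λ i i≤k → proj₂ (g≋h i i≤k))

≋-*ˡ : ∀ {a} c → 1 ≤ c → (λ t → c * a t) ≋ a
≋-*ˡ {a} c 1≤c = (c , 0 , λ t _ → ≤-refl) ,
                  ≤⇒≲ (λ t → ≤-trans (≤-reflexive (sym (*-identityˡ (a t)))) (*-monoˡ-≤ (a t) 1≤c))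

≋⇒Θ : ∀ {a b} → a ≋ b → Θ a b
≋⇒Θ {a} {b} ((k , s , a≤kb) , (l , u , b≤la)) = suc l , suc k , s ⊔ u , s≤s z≤n , s≤s z≤n , λ t t≥ →
  ≤-trans (b≤la t (≤-trans (m≤n⊔m s u) t≥)) (*-monoˡ-≤ (a t) (n≤1+n l)) ,
  ≤-trans (a≤kb t (≤-trans (m≤m⊔n s u) t≥)) (*-monoˡ-≤ (b t) (n≤1+n k))

infix 4 _≋[_]_

_≋[_]_ : GF → ℕ → GF → Set
F ≋[ M ] G = ∀ k → k < M → (λ t → F t k) ≋ (λ t → G t k)

≋[]-refl : ∀ {M F} → F ≋[ M ] F
≋[]-refl k _ = ≋-refl

≋[]-setoid : ℕ → Setoid _ _
≋[]-setoid M = record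
  { Carrier       = GF
  ; _≈_           = _≋[ M ]_
  ; isEquivalence = record
    { refl  = ≋[]-refl
    ; sym   = λ F≋G k k<M → ≋-sym (F≋G k k<M)
    ; trans = λ F≋G G≋H k k<M → ≋-trans (F≋G k k<M) (G≋H k k<M)
    }
  }

module ≋-Reasoning (M : ℕ) = SetoidReasoning (≋[]-setoid M)

≗⇒≋[] : ∀ {M F G} → (∀ t → F t ≗ G t) → F ≋[ M ] G
≗⇒≋[] F≗G k _ = ≗⇒≋ (λ t → F≗G t k)

≋[]-⊕ : ∀ {M F F′ G G′} → F ≋[ M ] F′ → G ≋[ M ] G′ → (λ t → F t ⊕ G t) ≋[ M ] (λ t → F′ t ⊕ G′ t)
≋[]-⊕ F≋F′ G≋G′ k k<M = ≋-+ (F≋F′ k k<M) (G≋G′ k k<M)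

≋[]-⊛ : ∀ {M F F′ G G′} → F ≋[ M ] F′ → G ≋[ M ] G′ → (λ t → F t ⊛ G t) ≋[ M ] (λ t → F′ t ⊛ G′ t)
≋[]-⊛ F≋F′ G≋G′ k k<M =
  ≋-sumTo k (λ i i≤k → ≋-* (F≋F′ i (≤-<-trans i≤k k<M)) (G≋G′ (k ∸ i) (≤-<-trans (m∸n≤m k i) k<M)))

≋[]-^^ : ∀ {M F G} n → F ≋[ M ] G → (λ t → F t ^^ n) ≋[ M ] (λ t → G t ^^ n)
≋[]-^^ zero    F≋G k _ = ≋-refl
≋[]-^^ (suc n) F≋G     = ≋[]-⊛ F≋G (≋[]-^^ n F≋G)

≋[]-shift : ∀ {M F G} → F ≋[ M ] G → (λ t → shift (F t)) ≋[ M ] (λ t → shift (G t))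
≋[]-shift F≋G zero    _   = ≋-refl
≋[]-shift F≋G (suc k) k<M = F≋G k (<-trans (n<1+n k) k<M)

≋[]⇒≍ : ∀ {M F G} → F ≋[ M ] G → F ≍ G mod M
≋[]⇒≍ F≋G k k<M = ≋⇒Θ (F≋G k k<M)

countB-++ : ∀ {A : Set} (p : A → Bool) xs ys → countB p (xs ++ ys) ≡ countB p xs + countB p ys
countB-++ p []       ys = refl
countB-++ p (x ∷ xs) ys with p x
... | true  = cong suc (countB-++ p xs ys)
... | false = countB-++ p xs ys

countB-map : ∀ {A B : Set} (p : B → Bool) (f : A → B) xs → countB p (map f xs) ≡ countB (λ x → p (f x)) xs
countB-map p f []       = refl
countB-map p f (x ∷ xs) with p (f x)
... | true  = cong suc (countB-map p f xs)
... | false = countB-map p f xs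

countB-cong : ∀ {A : Set} {p q : A → Bool} xs → (∀ x → p x ≡ q x) → countB p xs ≡ countB q xs
countB-cong []       p≡q = refl
countB-cong {q = q} (x ∷ xs) p≡q rewrite p≡q x with q x
... | true  = cong suc (countB-cong xs p≡q)
... | false = countB-cong xs p≡q

countB-false : ∀ {A : Set} {p : A → Bool} xs → (∀ x → p x ≡ false) → countB p xs ≡ 0
countB-false []       p≡false = refl
countB-false (x ∷ xs) p≡false rewrite p≡false x = countB-false xs p≡false

-- I G is definitionally count (order G) (isIndep G).
count : ℕ → (List Bool → Bool) → Series
count n P k = countB (λ s → P s ∧ (size s ≡ᵇ k)) (subsets n)

count-cong : ∀ n {P Q : List Bool → Bool} → (∀ s → P s ≡ Q s) → count n P ≗ count n Q
count-cong n P≡Q k = countB-cong (subsets n) (λ s → cong (_∧ (size s ≡ᵇ k)) (P≡Q s))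

count-false : ∀ n {P : List Bool → Bool} → (∀ s → P s ≡ false) → ∀ k → count n P k ≡ 0
count-false n P≡false k = countB-false (subsets n) (λ s → cong (_∧ (size s ≡ᵇ k)) (P≡false s))

count-suc : ∀ n (P : List Bool → Bool) →
            count (suc n) P ≗ shift (count n (λ s → P (true ∷ s))) ⊕ count n (λ s → P (false ∷ s))
count-suc n P k = begin
  countB p (map (true ∷_) (subsets n) ++ map (false ∷_) (subsets n))
    ≡⟨ countB-++ p (map (true ∷_) (subsets n)) (map (false ∷_) (subsets n)) ⟩
  countB p (map (true ∷_) (subsets n)) + countB p (map (false ∷_) (subsets n))
    ≡⟨ cong₂ _+_ (countB-map p (true ∷_) (subsets n)) (countB-map p (false ∷_) (subsets n)) ⟩
  countB (λ s → p (true ∷ s)) (subsets n) + count n (λ s → P (false ∷ s)) k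
    ≡⟨ cong (_+ count n (λ s → P (false ∷ s)) k) (true-part k) ⟩
  shift (count n (λ s → P (true ∷ s))) k + count n (λ s → P (false ∷ s)) k ∎
  where
  open ≡-Reasoning
  p : List Bool → Bool
  p s = P s ∧ (size s ≡ᵇ k)
  true-part : ∀ k → countB (λ s → P (true ∷ s) ∧ (size (true ∷ s) ≡ᵇ k)) (subsets n)
                  ≡ shift (count n (λ s → P (true ∷ s))) k
  true-part zero    = countB-false (subsets n) (λ s → ∧-zeroʳ (P (true ∷ s)))
  true-part (suc k) = refl

count-nil : ∀ (P : List Bool → Bool) → P [] ≡ true → count 0 P ≗ cst 1
count-nil P P[] zero    rewrite P[] = refl
count-nil P P[] (suc k) rewrite P[] = refl

count-nil-false : ∀ (P : List Bool → Bool) → P [] ≡ false → ∀ k → count 0 P k ≡ 0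
count-nil-false P P[] k rewrite P[] = refl

count-++ : ∀ n m (F G P : List Bool → Bool) →
           (∀ s₁ s₂ → length s₁ ≡ n → P (s₁ ++ s₂) ≡ F s₁ ∧ G s₂) →
           count (n + m) P ≗ count n F ⊛ count m G
count-++ zero    m F G P split = nil (F []) refl
  where
  nil : ∀ b → F [] ≡ b → count m P ≗ count 0 F ⊛ count m G
  nil true  F[] = begin
    count m P              ≈⟨ count-cong m (λ s → trans (split [] s refl) (cong (_∧ G s) F[])) ⟩
    count m G              ≈⟨ ⊛-identityˡ (count m G) ⟨
    cst 1 ⊛ count m G      ≈⟨ ⊛-congˡ (count m G) (count-nil F F[]) ⟨
    count 0 F ⊛ count m G  ∎
    where open ≗-Reasoning
  nil false F[] k = trans (count-false m (λ s → trans (split [] s refl) (cong (_∧ G s) F[])) k)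
                          (sym (sumTo-zero k (λ i _ → cong (_* count m G (k ∸ i)) (count-nil-false F F[] i))))
count-++ (suc n) m F G P split = begin
  count (suc n + m) P
    ≈⟨ count-suc (n + m) P ⟩
  shift (count (n + m) (λ s → P (true ∷ s))) ⊕ count (n + m) (λ s → P (false ∷ s))
    ≈⟨ ⊕-cong (shift-cong (after true)) (after false) ⟩
  shift (Fₜ ⊛ count m G) ⊕ F₀ ⊛ count m G
    ≈⟨ ⊕-cong (shift-⊛ Fₜ (count m G)) ≗-refl ⟨
  shift Fₜ ⊛ count m G ⊕ F₀ ⊛ count m G
    ≈⟨ ⊛-distribʳ-⊕ (count m G) (shift Fₜ) F₀ ⟨
  (shift Fₜ ⊕ F₀) ⊛ count m G
    ≈⟨ ⊛-congˡ (count m G) (count-suc n F) ⟨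
  count (suc n) F ⊛ count m G ∎
  where
  open ≗-Reasoning
  Fₜ = count n (λ s → F (true ∷ s))
  F₀ = count n (λ s → F (false ∷ s))
  after : ∀ b → count (n + m) (λ s → P (b ∷ s)) ≗ count n (λ s → F (b ∷ s)) ⊛ count m G
  after b = count-++ n m (λ s → F (b ∷ s)) G (λ s → P (b ∷ s)) (λ s₁ s₂ eq → split (b ∷ s₁) s₂ (cong suc eq))

-- j disjoint copies of a block of n vertices
count-blocks : ∀ n (F : List Bool → Bool) (P : ℕ → List Bool → Bool) →
               (∀ s → P 0 s ≡ true) →
               (∀ j s₁ s₂ → length s₁ ≡ n → P (suc j) (s₁ ++ s₂) ≡ F s₁ ∧ P j s₂) →
               ∀ j → count (j * n) (P j) ≗ count n F ^^ j
count-blocks n F P P₀ split zero    = count-nil (P 0) (P₀ [])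
count-blocks n F P P₀ split (suc j) =
  ≗-trans (count-++ n (j * n) F (P j) (P (suc j)) (split j))
          (⊛-congʳ (count n F) (count-blocks n F P P₀ split j))

-- Independent sets of the two trees

allBelow : ℕ → (ℕ → Bool) → Bool
allBelow zero    h = true
allBelow (suc t) h = h 0 ∧ allBelow t (λ i → h (suc i))

allBelow-cong : ∀ t {g h : ℕ → Bool} → (∀ i → i < t → g i ≡ h i) → allBelow t g ≡ allBelow t h
allBelow-cong zero    g≡h = refl
allBelow-cong (suc t) g≡h = cong₂ _∧_ (g≡h 0 (s≤s z≤n)) (allBelow-cong t (λ i i<t → g≡h (suc i) (s≤s i<t)))

allB-++ : ∀ {A : Set} (p : A → Bool) xs ys → allB p (xs ++ ys) ≡ allB p xs ∧ allB p ys
allB-++ p []       ys = refl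
allB-++ p (x ∷ xs) ys with p x
... | true  = allB-++ p xs ys
... | false = refl

allB-applyUpTo : ∀ (p : ℕ → Bool) (f : ℕ → ℕ) t → allB p (applyUpTo f t) ≡ allBelow t (λ i → p (f i))
allB-applyUpTo p f zero    = refl
allB-applyUpTo p f (suc t) = cong (p (f 0) ∧_) (allB-applyUpTo p (λ i → f (suc i)) t)

allB-concatMap-upTo : ∀ {A : Set} (p : A → Bool) (f : ℕ → List A) t →
                      allB p (concatMap f (upTo t)) ≡ allBelow t (λ i → allB p (f i))
allB-concatMap-upTo p f t = trans (concatMap-lemma (upTo t)) (allB-applyUpTo (λ i → allB p (f i)) (λ i → i) t)
  where
  concatMap-lemma : ∀ xs → allB p (concatMap f xs) ≡ allB (λ i → allB p (f i)) xs
  concatMap-lemma []       = refl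
  concatMap-lemma (x ∷ xs) = trans (allB-++ p (f x) (concatMap f xs)) (cong (allB p (f x) ∧_) (concatMap-lemma xs))

-- The i-th pendant copy of P₂ occupies positions 2i and 2i + 1 of s; b says
-- whether the vertex it hangs from is in the set.
pendants : Bool → ℕ → List Bool → Bool
pendants b t s =
  allBelow t (λ i → not (b ∧ mem s (2 * i)) ∧ (not (mem s (2 * i) ∧ mem s (suc (2 * i))) ∧ true))

pendantP₂ : Bool → List Bool → Bool
pendantP₂ b (x ∷ y ∷ _) = not (b ∧ x) ∧ (not (x ∧ y) ∧ true)
pendantP₂ b _           = true

isIndep-S2 : ∀ t b s → isIndep (S2 t) (b ∷ s) ≡ pendants b t s
isIndep-S2 t b s = allB-concatMap-upTo _ _ t

pendants-++ : ∀ b t s₁ s₂ → length s₁ ≡ 2 → pendants b (suc t) (s₁ ++ s₂) ≡ pendantP₂ b s₁ ∧ pendants b t s₂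
pendants-++ b t (x ∷ y ∷ []) s₂ _ = cong (pendantP₂ b (x ∷ y ∷ []) ∧_) (allBelow-cong t (λ i _ → edges-at i))
  where
  s = x ∷ y ∷ s₂
  edges-at : ∀ i → (not (b ∧ mem s (2 * suc i)) ∧ (not (mem s (2 * suc i) ∧ mem s (suc (2 * suc i))) ∧ true))
                 ≡ (not (b ∧ mem s₂ (2 * i)) ∧ (not (mem s₂ (2 * i) ∧ mem s₂ (suc (2 * i))) ∧ true))
  edges-at i = cong (λ j → not (b ∧ mem s j) ∧ (not (mem s j ∧ mem s (suc j)) ∧ true)) (*-suc 2 i)

count-pendantP₂-true : count 2 (pendantP₂ true) ≗ linPow 1 1 1
count-pendantP₂-true zero                = refl
count-pendantP₂-true (suc zero)          = refl
count-pendantP₂-true (suc (suc zero))    = refl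
count-pendantP₂-true (suc (suc (suc k))) = refl

count-pendantP₂-false : count 2 (pendantP₂ false) ≗ linPow 1 2 1
count-pendantP₂-false zero                = refl
count-pendantP₂-false (suc zero)          = refl
count-pendantP₂-false (suc (suc zero))    = refl
count-pendantP₂-false (suc (suc (suc k))) = refl

count-pendants : ∀ b t → count (2 * t) (pendants b t) ≗ count 2 (pendantP₂ b) ^^ t
count-pendants b t k =
  trans (cong (λ n → count n (pendants b t) k) (*-comm 2 t))
        (count-blocks 2 (pendantP₂ b) (pendants b) (λ _ → refl) (pendants-++ b) t k)

count-pendants-true : ∀ t → count (2 * t) (pendants true t) ≗ binomial t
count-pendants-true t =
  ≗-trans (count-pendants true t) (≗-trans (^^-cong t count-pendantP₂-true) (linPow-1-^^ 1 1 t))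

count-pendants-false : ∀ t → count (2 * t) (pendants false t) ≗ linPow 1 2 t
count-pendants-false t =
  ≗-trans (count-pendants false t) (≗-trans (^^-cong t count-pendantP₂-false) (linPow-1-^^ 1 2 t))

polyS2 : ℕ → Series
polyS2 t = shift (binomial t) ⊕ linPow 1 2 t

count-star : ∀ t → shift (count (2 * t) (pendants true t)) ⊕ count (2 * t) (pendants false t) ≗ polyS2 t
count-star t = ⊕-cong (shift-cong (count-pendants-true t)) (count-pendants-false t)

I-S2 : ∀ t → I (S2 t) ≗ polyS2 t
I-S2 t = begin
  I (S2 t)
    ≈⟨ count-suc (2 * t) (isIndep (S2 t)) ⟩
  shift (count (2 * t) (λ s → isIndep (S2 t) (true ∷ s))) ⊕ count (2 * t) (λ s → isIndep (S2 t) (false ∷ s))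
    ≈⟨ ⊕-cong (shift-cong (count-cong (2 * t) (isIndep-S2 t true))) (count-cong (2 * t) (isIndep-S2 t false)) ⟩
  shift (count (2 * t) (pendants true t)) ⊕ count (2 * t) (pendants false t)
    ≈⟨ count-star t ⟩
  polyS2 t ∎
  where open ≗-Reasoning

-- The branch of T₃,ₜ at its child in position o of s (its pendant copies of P₂
-- follow at o + 1, o + 2, ...); b says whether the root is in the set.
branch : ℕ → Bool → ℕ → List Bool → Bool
branch t b o s = not (b ∧ mem s o) ∧
  allBelow t (λ i → not (mem s o ∧ mem s (o + 1 + 2 * i)) ∧ (not (mem s (o + 1 + 2 * i) ∧ mem s (o + 2 + 2 * i)) ∧ true))

branches : ℕ → Bool → ℕ → List Bool → Bool
branches t b j s = allBelow j (λ i → branch t b (i * suc (2 * t)) s)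

allB-edges-T3 : ∀ t (p : ℕ × ℕ → Bool) → allB p (edges (T3 t)) ≡
  allBelow 3 (λ j → p (0 , suc (j * suc (2 * t))) ∧
    allBelow t (λ i → p (suc (j * suc (2 * t)) , suc (j * suc (2 * t)) + 1 + 2 * i) ∧
                     (p (suc (j * suc (2 * t)) + 1 + 2 * i , suc (j * suc (2 * t)) + 2 + 2 * i) ∧ true)))
allB-edges-T3 t p = trans (allB-concatMap-upTo p block 3)
  (allBelow-cong 3 (λ j _ → cong (p (0 , suc (j * suc (2 * t))) ∧_) (allB-concatMap-upTo p (pairs (suc (j * suc (2 * t)))) t)))
  where
  pairs : ℕ → ℕ → List (ℕ × ℕ)
  pairs c i = (c , c + 1 + 2 * i) ∷ (c + 1 + 2 * i , c + 2 + 2 * i) ∷ []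
  block : ℕ → List (ℕ × ℕ)
  block j = (0 , suc (j * suc (2 * t))) ∷ concatMap (pairs (suc (j * suc (2 * t)))) (upTo t)

isIndep-T3 : ∀ t b s → isIndep (T3 t) (b ∷ s) ≡ branches t b 3 s
isIndep-T3 t b s = allB-edges-T3 t _

branch-drop : ∀ t b s₁ s₂ o → branch t b (length s₁ + o) (s₁ ++ s₂) ≡ branch t b o s₂
branch-drop t b []       s₂ o = refl
branch-drop t b (_ ∷ s₁) s₂ o = branch-drop t b s₁ s₂ o

mem-++ : ∀ s₁ s₂ {i} → i < length s₁ → mem (s₁ ++ s₂) i ≡ mem s₁ i
mem-++ (x ∷ s₁) s₂ {zero}  _         = refl
mem-++ (x ∷ s₁) s₂ {suc i} (s≤s i<n) = mem-++ s₁ s₂ i<n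

branch-take : ∀ t b s₁ s₂ → length s₁ ≡ suc (2 * t) → branch t b 0 (s₁ ++ s₂) ≡ branch t b 0 s₁
branch-take t b (c ∷ s₁) s₂ len = cong (not (b ∧ c) ∧_) (allBelow-cong t (λ i i<t →
    cong₂ (λ u v → not (c ∧ u) ∧ (not (u ∧ v) ∧ true)) (mem-++ s₁ s₂ (<-trans (n<1+n (2 * i)) (odd< i<t)))
                                                     (mem-++ s₁ s₂ (odd< i<t))))
  where
  odd< : ∀ {i} → i < t → suc (2 * i) < length s₁
  odd< {i} i<t = subst (suc (2 * i) <_) (sym (suc-injective len)) (subst (_≤ 2 * t) (*-suc 2 i) (*-monoʳ-≤ 2 i<t))

branches-++ : ∀ t b j s₁ s₂ → length s₁ ≡ suc (2 * t) → branches t b (suc j) (s₁ ++ s₂) ≡ branch t b 0 s₁ ∧ branches t b j s₂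
branches-++ t b j s₁ s₂ len = cong₂ _∧_ (branch-take t b s₁ s₂ len) (allBelow-cong j (λ i _ →
  trans (cong (λ o → branch t b (o + i * suc (2 * t)) (s₁ ++ s₂)) (sym len)) (branch-drop t b s₁ s₂ _)))

count-branch-true : ∀ t → count (suc (2 * t)) (branch t true 0) ≗ linPow 1 2 t
count-branch-true t = begin
  count (suc (2 * t)) (branch t true 0)
    ≈⟨ count-suc (2 * t) (branch t true 0) ⟩
  shift (count (2 * t) (λ s → false ∧ pendants true t s)) ⊕ count (2 * t) (pendants false t)
    ≈⟨ ⊕-cong (shift-cong (count-false (2 * t) (λ _ → refl))) (count-pendants-false t) ⟩
  shift (λ _ → 0) ⊕ linPow 1 2 t
    ≈⟨ (λ { zero → refl ; (suc k) → refl }) ⟩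
  linPow 1 2 t ∎
  where open ≗-Reasoning

count-branch-false : ∀ t → count (suc (2 * t)) (branch t false 0) ≗ polyS2 t
count-branch-false t = ≗-trans (count-suc (2 * t) (branch t false 0)) (count-star t)

I-T3 : ∀ t → I (T3 t) ≗ shift (linPow 1 2 t ^^ 3) ⊕ polyS2 t ^^ 3
I-T3 t = begin
  I (T3 t)
    ≈⟨ count-suc (3 * n) (isIndep (T3 t)) ⟩
  shift (count (3 * n) (λ s → isIndep (T3 t) (true ∷ s))) ⊕ count (3 * n) (λ s → isIndep (T3 t) (false ∷ s))
    ≈⟨ ⊕-cong (shift-cong (count-cong (3 * n) (isIndep-T3 t true))) (count-cong (3 * n) (isIndep-T3 t false)) ⟩
  shift (count (3 * n) (branches t true 3)) ⊕ count (3 * n) (branches t false 3)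
    ≈⟨ ⊕-cong (shift-cong (cube true)) (cube false) ⟩
  shift (count n (branch t true 0) ^^ 3) ⊕ count n (branch t false 0) ^^ 3
    ≈⟨ ⊕-cong (shift-cong (^^-cong 3 (count-branch-true t))) (^^-cong 3 (count-branch-false t)) ⟩
  shift (linPow 1 2 t ^^ 3) ⊕ polyS2 t ^^ 3 ∎
  where
  open ≗-Reasoning
  n = suc (2 * t)
  cube : ∀ b → count (3 * n) (branches t b 3) ≗ count n (branch t b 0) ^^ 3
  cube b = count-blocks n (branch t b 0) (branches t b) (λ _ → refl) (branches-++ t b) 3

-- Degrees and reflected polynomials

DegreeAtMost : ℕ → Series → Set
DegreeAtMost d f = ∀ k → d < k → f k ≡ 0

deg-mono : ∀ {d e f} → d ≤ e → DegreeAtMost d f → DegreeAtMost e f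
deg-mono d≤e deg k e<k = deg k (≤-<-trans d≤e e<k)

deg-cst : ∀ c d → DegreeAtMost d (cst c)
deg-cst c d (suc k) _ = refl

deg-shift : ∀ {d f} → DegreeAtMost d f → DegreeAtMost (suc d) (shift f)
deg-shift deg (suc k) (s≤s d<k) = deg k d<k

deg-tail : ∀ {d f} → DegreeAtMost (suc d) f → DegreeAtMost d (tail f)
deg-tail deg k d<k = deg (suc k) (s≤s d<k)

deg-⊕ : ∀ {d f g} → DegreeAtMost d f → DegreeAtMost d g → DegreeAtMost d (f ⊕ g)
deg-⊕ deg-f deg-g k d<k = cong₂ _+_ (deg-f k d<k) (deg-g k d<k)

deg-⊛ : ∀ {d₁ d₂ f g} → DegreeAtMost d₁ f → DegreeAtMost d₂ g → DegreeAtMost (d₁ + d₂) (f ⊛ g)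
deg-⊛ {d₁} {d₂} {f} {g} deg-f deg-g k d<k = sumTo-zero k term
  where
  term : ∀ i → i ≤ k → f i * g (k ∸ i) ≡ 0
  term i i≤k with ≤-<-connex i d₁
  ... | inj₁ i≤d₁ = trans (cong (f i *_) (deg-g (k ∸ i) (+-cancelˡ-< i d₂ (k ∸ i)
                      (subst (i + d₂ <_) (sym (m+[n∸m]≡n i≤k)) (≤-<-trans (+-monoˡ-≤ d₂ i≤d₁) d<k)))))
                      (*-zeroʳ (f i))
  ... | inj₂ d₁<i = cong (_* g (k ∸ i)) (deg-f i d₁<i)

deg-^^ : ∀ {d f} n → DegreeAtMost d f → DegreeAtMost (n * d) (f ^^ n)
deg-^^ zero    deg (suc k) _ = refl
deg-^^ (suc n) deg = deg-⊛ deg (deg-^^ n deg)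

deg-linPow : ∀ a b n → DegreeAtMost n (linPow a b n)
deg-linPow a b n k n<k = linPow-vanish a b n n<k

R-≤ : ∀ n p {k} → k ≤ n → R n p k ≡ p (n ∸ k)
R-≤ n p {k} k≤n with k ≤ᵇ n | ≤⇒≤ᵇ k≤n
... | true | _ = refl

R-> : ∀ n p {k} → n < k → R n p k ≡ 0
R-> n p {k} n<k with k ≤ᵇ n in eq
... | true  = ⊥-elim (<⇒≱ n<k (≤ᵇ⇒≤ k n (subst T (sym eq) tt)))
... | false = refl

R-cong : ∀ n {p q} → p ≗ q → R n p ≗ R n q
R-cong n p≗q k with k ≤ᵇ n
... | true  = p≗q (n ∸ k)
... | false = refl

R-⊕ : ∀ n p q → R n (p ⊕ q) ≗ R n p ⊕ R n q
R-⊕ n p q k with k ≤ᵇ n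
... | true  = refl
... | false = refl

R-scale : ∀ n c p → R n (scale c p) ≗ scale c (R n p)
R-scale n c p k with k ≤ᵇ n
... | true  = refl
... | false = sym (*-zeroʳ c)

R-zero : ∀ f → DegreeAtMost 0 f → R 0 f ≗ cst (f 0)
R-zero f deg zero    = refl
R-zero f deg (suc k) = R-> 0 f {suc k} (s≤s z≤n)

R-shift : ∀ d f → R (suc d) (shift f) ≗ R d f
R-shift d f k with ≤-<-connex k d
... | inj₁ k≤d = begin
  R (suc d) (shift f) k   ≡⟨ R-≤ (suc d) (shift f) (m≤n⇒m≤1+n k≤d) ⟩
  shift f (suc d ∸ k)     ≡⟨ cong (shift f) (+-∸-assoc 1 k≤d) ⟩
  f (d ∸ k)               ≡⟨ R-≤ d f k≤d ⟨
  R d f k                 ∎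
  where open ≡-Reasoning
... | inj₂ d<k with ≤-<-connex k (suc d)
...   | inj₁ k≤1+d = begin
  R (suc d) (shift f) k   ≡⟨ R-≤ (suc d) (shift f) k≤1+d ⟩
  shift f (suc d ∸ k)     ≡⟨ cong (λ i → shift f (suc d ∸ i)) (≤-antisym k≤1+d d<k) ⟩
  shift f (suc d ∸ suc d) ≡⟨ cong (shift f) (n∸n≡0 (suc d)) ⟩
  0                       ≡⟨ R-> d f d<k ⟨
  R d f k                 ∎
  where open ≡-Reasoning
...   | inj₂ 1+d<k = trans (R-> (suc d) (shift f) 1+d<k) (sym (R-> d f d<k))

R-suc : ∀ d f → DegreeAtMost d f → R (suc d) f ≗ shift (R d f)
R-suc d f deg zero    = trans (R-≤ (suc d) f z≤n) (deg (suc d) ≤-refl)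
R-suc d f deg (suc k) with ≤-<-connex k d
... | inj₁ k≤d = trans (R-≤ (suc d) f (s≤s k≤d)) (sym (R-≤ d f k≤d))
... | inj₂ d<k = trans (R-> (suc d) f (s≤s d<k)) (sym (R-> d f d<k))

R-cst-⊛ : ∀ e c g d → DegreeAtMost d g → R e (cst c) ⊛ R d g ≗ scale c (R (e + d) g)
R-cst-⊛ zero    c g d deg = ≗-trans (⊛-congˡ (R d g) (R-zero (cst c) (deg-cst c 0))) (cst-⊛ c (R d g))
R-cst-⊛ (suc e) c g d deg = begin
  R (suc e) (cst c) ⊛ R d g        ≈⟨ ⊛-congˡ (R d g) (R-suc e (cst c) (deg-cst c e)) ⟩
  shift (R e (cst c)) ⊛ R d g      ≈⟨ shift-⊛ (R e (cst c)) (R d g) ⟩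
  shift (R e (cst c) ⊛ R d g)      ≈⟨ shift-cong (R-cst-⊛ e c g d deg) ⟩
  shift (scale c (R (e + d) g))    ≈⟨ shift-scale c (R (e + d) g) ⟩
  scale c (shift (R (e + d) g))    ≈⟨ (λ k → cong (c *_) (R-suc (e + d) g (deg-mono (m≤n+m d e) deg) k)) ⟨
  scale c (R (suc e + d) g)        ∎
  where open ≗-Reasoning

R-⊛ : ∀ d₁ d₂ f g → DegreeAtMost d₁ f → DegreeAtMost d₂ g → R (d₁ + d₂) (f ⊛ g) ≗ R d₁ f ⊛ R d₂ g
R-⊛ zero     d₂ f g deg-f deg-g = begin
  R d₂ (f ⊛ g)                ≈⟨ R-cong d₂ (≗-trans (⊛-congˡ g f≗f₀) (cst-⊛ (f 0) g)) ⟩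
  R d₂ (scale (f 0) g)        ≈⟨ R-scale d₂ (f 0) g ⟩
  scale (f 0) (R d₂ g)        ≈⟨ cst-⊛ (f 0) (R d₂ g) ⟨
  cst (f 0) ⊛ R d₂ g          ≈⟨ ⊛-congˡ (R d₂ g) (R-zero f deg-f) ⟨
  R 0 f ⊛ R d₂ g              ∎
  where
  open ≗-Reasoning
  f≗f₀ : f ≗ cst (f 0)
  f≗f₀ zero    = refl
  f≗f₀ (suc k) = deg-f (suc k) (s≤s z≤n)
R-⊛ (suc d₁) d₂ f g deg-f deg-g = begin
  R (suc d₁ + d₂) (f ⊛ g)
    ≈⟨ R-cong (suc d₁ + d₂) (⊛-split f g) ⟩
  R (suc d₁ + d₂) (scale (f 0) g ⊕ shift (tail f ⊛ g))
    ≈⟨ R-⊕ (suc d₁ + d₂) (scale (f 0) g) (shift (tail f ⊛ g)) ⟩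
  R (suc d₁ + d₂) (scale (f 0) g) ⊕ R (suc d₁ + d₂) (shift (tail f ⊛ g))
    ≈⟨ ⊕-cong (R-scale (suc d₁ + d₂) (f 0) g) (R-shift (d₁ + d₂) (tail f ⊛ g)) ⟩
  scale (f 0) (R (suc d₁ + d₂) g) ⊕ R (d₁ + d₂) (tail f ⊛ g)
    ≈⟨ ⊕-cong (≗-sym (R-cst-⊛ (suc d₁) (f 0) g d₂ deg-g)) (R-⊛ d₁ d₂ (tail f) g (deg-tail deg-f) deg-g) ⟩
  R (suc d₁) (cst (f 0)) ⊛ R d₂ g ⊕ R d₁ (tail f) ⊛ R d₂ g
    ≈⟨ ⊛-distribʳ-⊕ (R d₂ g) (R (suc d₁) (cst (f 0))) (R d₁ (tail f)) ⟨
  (R (suc d₁) (cst (f 0)) ⊕ R d₁ (tail f)) ⊛ R d₂ g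
    ≈⟨ ⊛-congˡ (R d₂ g) (⊕-cong {R (suc d₁) (cst (f 0))} ≗-refl (R-shift d₁ (tail f))) ⟨
  (R (suc d₁) (cst (f 0)) ⊕ R (suc d₁) (shift (tail f))) ⊛ R d₂ g
    ≈⟨ ⊛-congˡ (R d₂ g) (R-⊕ (suc d₁) (cst (f 0)) (shift (tail f))) ⟨
  R (suc d₁) (cst (f 0) ⊕ shift (tail f)) ⊛ R d₂ g
    ≈⟨ ⊛-congˡ (R d₂ g) (R-cong (suc d₁) f≗) ⟨
  R (suc d₁) f ⊛ R d₂ g ∎
  where
  open ≗-Reasoning
  f≗ : f ≗ cst (f 0) ⊕ shift (tail f)
  f≗ zero    = sym (+-identityʳ (f 0))
  f≗ (suc k) = refl

R-^^ : ∀ d f n → DegreeAtMost d f → R (n * d) (f ^^ n) ≗ R d f ^^ n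
R-^^ d f zero    deg = R-zero (cst 1) (deg-cst 1 0)
R-^^ d f (suc n) deg =
  ≗-trans (R-⊛ d (n * d) f (f ^^ n) deg (deg-^^ n deg)) (⊛-congʳ (R d f) (R-^^ d f n deg))

R-linPow : ∀ a b n → R n (linPow a b n) ≗ linPow b a n
R-linPow a b n k with ≤-<-connex k n
... | inj₁ k≤n = trans (R-≤ n (linPow a b n) k≤n) (linPow-swap a b n (n ∸ k) k (m∸n+n≡m k≤n))
... | inj₂ n<k = trans (R-> n (linPow a b n) n<k) (sym (linPow-vanish b a n n<k))

degFrom-exact : ∀ s n d → d ≤ n → ¬ (s d ≡ 0) → DegreeAtMost d s → degFrom s n ≡ d
degFrom-exact s zero    zero    _   _    _   = refl
degFrom-exact s (suc n) d       d≤n sd≢0 deg with ≤-<-connex d n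
... | inj₁ d≤n′ rewrite deg (suc n) (s≤s d≤n′) = degFrom-exact s n d d≤n′ sd≢0 deg
... | inj₂ n<d with ≤-antisym d≤n n<d
...   | refl with s (suc n) in eq
...     | zero  = ⊥-elim (sd≢0 refl)
...     | suc _ = refl

-- A nonzero constant term of R d p means p has degree exactly d.
RI-exact : ∀ G d p q → I G ≗ p → DegreeAtMost d p → R d p ≗ q → ¬ (q 0 ≡ 0) → d ≤ order G → RI G ≗ q
RI-exact G d p q I≗p deg Rp≗q q₀≢0 d≤n = begin
  R (degI G) (I G)  ≈⟨ (λ k → cong (λ e → R e (I G) k) degI≡d) ⟩
  R d (I G)         ≈⟨ R-cong d I≗p ⟩
  R d p             ≈⟨ Rp≗q ⟩
  q                 ∎
  where
  open ≗-Reasoning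
  degI≡d : degI G ≡ d
  degI≡d = degFrom-exact (I G) (order G) d d≤n
                         (λ Id≡0 → q₀≢0 (trans (sym (Rp≗q 0)) (trans (R-≤ d p z≤n) (trans (sym (I≗p d)) Id≡0))))
                         (λ k d<k → trans (I≗p k) (deg k d<k))

E : ℕ → Series
E = linPow 2 1

polyRS2 : ℕ → Series
polyRS2 t = binomial t ⊕ shift (E t)

polyRS2-constant : ∀ t → polyRS2 t 0 ≡ 1
polyRS2-constant t = trans (+-identityʳ _) (trans (linPow-constant 1 1 t) (^-zeroˡ t))

deg-polyS2 : ∀ t → DegreeAtMost (suc t) (polyS2 t)
deg-polyS2 t = deg-⊕ (deg-shift (deg-linPow 1 1 t)) (deg-mono (n≤1+n t) (deg-linPow 1 2 t))

R-polyS2 : ∀ t → R (suc t) (polyS2 t) ≗ polyRS2 t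
R-polyS2 t = begin
  R (suc t) (shift (binomial t) ⊕ linPow 1 2 t)              ≈⟨ R-⊕ (suc t) (shift (binomial t)) (linPow 1 2 t) ⟩
  R (suc t) (shift (binomial t)) ⊕ R (suc t) (linPow 1 2 t)  ≈⟨ ⊕-cong (R-shift t (binomial t)) (R-suc t (linPow 1 2 t) (deg-linPow 1 2 t)) ⟩
  R t (binomial t) ⊕ shift (R t (linPow 1 2 t))              ≈⟨ ⊕-cong (R-linPow 1 1 t) (shift-cong (R-linPow 1 2 t)) ⟩
  binomial t ⊕ shift (E t)                                   ∎
  where open ≗-Reasoning

RI-S2 : ∀ t → RI (S2 t) ≗ polyRS2 t
RI-S2 t = RI-exact (S2 t) (suc t) (polyS2 t) (polyRS2 t) (I-S2 t) (deg-polyS2 t) (R-polyS2 t)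
                   (λ q₀≡0 → 1+n≢0 (trans (sym (polyRS2-constant t)) q₀≡0)) (s≤s (m≤m+n t (t + 0)))

polyRT3 : ℕ → Series
polyRT3 t = polyRS2 t ^^ 3 ⊕ shift (shift (E (3 * t)))

R-shift-cube : ∀ t → R (3 * suc t) (shift (linPow 1 2 t ^^ 3)) ≗ shift (shift (E (3 * t)))
R-shift-cube t = begin
  R (3 * suc t) (shift A³)                  ≈⟨ (λ k → cong (λ e → R e (shift A³) k) (*-suc 3 t)) ⟩
  R (suc (suc (suc (3 * t)))) (shift A³)    ≈⟨ R-shift (suc (suc (3 * t))) A³ ⟩
  R (suc (suc (3 * t))) A³                  ≈⟨ R-suc (suc (3 * t)) A³ (deg-mono (n≤1+n _) deg-A³) ⟩
  shift (R (suc (3 * t)) A³)                ≈⟨ shift-cong (R-suc (3 * t) A³ deg-A³) ⟩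
  shift (shift (R (3 * t) A³))              ≈⟨ shift-cong (shift-cong (R-^^ t (linPow 1 2 t) 3 (deg-linPow 1 2 t))) ⟩
  shift (shift (R t (linPow 1 2 t) ^^ 3))   ≈⟨ shift-cong (shift-cong (^^-cong 3 (R-linPow 1 2 t))) ⟩
  shift (shift (E t ^^ 3))                  ≈⟨ shift-cong (shift-cong (linPow-^^ 2 1 t 3)) ⟩
  shift (shift (E (3 * t)))                 ∎
  where
  open ≗-Reasoning
  A³ = linPow 1 2 t ^^ 3
  deg-A³ : DegreeAtMost (3 * t) A³
  deg-A³ = deg-^^ 3 (deg-linPow 1 2 t)

RI-T3 : ∀ t → RI (T3 t) ≗ polyRT3 t
RI-T3 t = RI-exact (T3 t) (3 * suc t) (shift A³ ⊕ polyS2 t ^^ 3) (polyRT3 t) (I-T3 t) deg R≗ q₀≢0 d≤n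
  where
  A³ = linPow 1 2 t ^^ 3
  deg : DegreeAtMost (3 * suc t) (shift A³ ⊕ polyS2 t ^^ 3)
  deg = deg-⊕ (deg-mono (≤-trans (n≤1+n _) (≤-trans (n≤1+n _) (≤-reflexive (sym (*-suc 3 t)))))
                        (deg-shift (deg-^^ 3 (deg-linPow 1 2 t))))
              (deg-^^ 3 (deg-polyS2 t))
  R≗ : R (3 * suc t) (shift A³ ⊕ polyS2 t ^^ 3) ≗ polyRT3 t
  R≗ = begin
    R (3 * suc t) (shift A³ ⊕ polyS2 t ^^ 3)                 ≈⟨ R-⊕ (3 * suc t) (shift A³) (polyS2 t ^^ 3) ⟩
    R (3 * suc t) (shift A³) ⊕ R (3 * suc t) (polyS2 t ^^ 3) ≈⟨ ⊕-cong (R-shift-cube t) (R-^^ (suc t) (polyS2 t) 3 (deg-polyS2 t)) ⟩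
    shift (shift (E (3 * t))) ⊕ R (suc t) (polyS2 t) ^^ 3    ≈⟨ ⊕-cong {shift (shift (E (3 * t)))} ≗-refl (^^-cong 3 (R-polyS2 t)) ⟩
    shift (shift (E (3 * t))) ⊕ polyRS2 t ^^ 3               ≈⟨ (λ k → +-comm (shift (shift (E (3 * t))) k) _) ⟩
    polyRT3 t                                                ∎
    where open ≗-Reasoning
  q₀≢0 : ¬ (polyRT3 t 0 ≡ 0)
  q₀≢0 q₀≡0 = 1+n≢0 (trans (cong (λ z → z * (z * (z * 1)) + 0) (sym (polyRS2-constant t))) q₀≡0)
  d≤n : 3 * suc t ≤ order (T3 t)
  d≤n = m≤n⇒m≤1+n (*-monoʳ-≤ 3 (s≤s (m≤m+n t (t + 0))))

-- Growth of coefficients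

n≤2^n : ∀ n → n ≤ 2 ^ n
n≤2^n zero    = z≤n
n≤2^n (suc n) = begin
  suc n            ≤⟨ s≤s (n≤2^n n) ⟩
  suc (2 ^ n)      ≡⟨ +-comm 1 (2 ^ n) ⟩
  2 ^ n + 1        ≤⟨ +-monoʳ-≤ (2 ^ n) (m^n>0 2 n) ⟩
  2 ^ n + 2 ^ n    ≡⟨ cong (2 ^ n +_) (+-identityʳ (2 ^ n)) ⟨
  2 ^ suc n        ∎
  where open ≤-Reasoning

exp2 : ℕ → ℕ → ℕ
exp2 e t = 2 ^ (e * t)

exp2-+ : ∀ d e t → exp2 d t * exp2 e t ≡ exp2 (d + e) t
exp2-+ d e t = trans (sym (^-distribˡ-+-* 2 (d * t) (e * t))) (cong (2 ^_) (sym (*-distribʳ-+ t d e)))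

exp2-mono : ∀ {d e} t → d ≤ e → exp2 d t ≤ exp2 e t
exp2-mono t d≤e = ^-monoʳ-≤ 2 (*-monoˡ-≤ t d≤e)

E-constant : ∀ n → E n 0 ≡ 2 ^ n
E-constant = linPow-constant 2 1

-- keep only the constant term of (2 + x) ^ m
E-+-≥ : ∀ m n j → 2 ^ m * E n j ≤ E (m + n) j
E-+-≥ m n j = begin
  2 ^ m * E n j       ≡⟨ cong (_* E n j) (E-constant m) ⟨
  E m 0 * E n j       ≤⟨ ≤-sumTo j (λ i → E m i * E n (j ∸ i)) z≤n ⟩
  (E m ⊛ E n) j       ≡⟨ linPow-+ 2 1 m n j ⟩
  E (m + n) j         ∎
  where open ≤-Reasoning

binomial-suc≤E : ∀ t j → binomial t (suc j) ≤ 2 ^ j * E t j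
binomial-suc≤E t j = begin
  binomial t (suc j)   ≤⟨ binomial-suc≤ t j ⟩
  t * binomial t j     ≤⟨ *-monoˡ-≤ (binomial t j) (n≤2^n t) ⟩
  2 ^ t * binomial t j ≡⟨ linPow-binomial 2 t j ⟨
  2 ^ j * E t j        ∎
  where open ≤-Reasoning

-- via c t ≤ 2 ^ (c + t)
E-growth : ∀ c i → (λ t → E (c * t) i) ≲ exp2 (c + i)
E-growth c i = 2 ^ (c * i) , 0 , λ t _ → begin
  E (c * t) i                               ≤⟨ linPow≤ 2 (c * t) i ⟩
  (c * t) ^ i * 2 ^ (c * t)                 ≤⟨ *-monoˡ-≤ (2 ^ (c * t)) (^-monoˡ-≤ i (*-mono-≤ (n≤2^n c) (n≤2^n t))) ⟩
  (2 ^ c * 2 ^ t) ^ i * 2 ^ (c * t)         ≡⟨ cong (λ b → b ^ i * 2 ^ (c * t)) (^-distribˡ-+-* 2 c t) ⟨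
  (2 ^ (c + t)) ^ i * 2 ^ (c * t)           ≡⟨ cong (_* 2 ^ (c * t)) (^-*-assoc 2 (c + t) i) ⟩
  2 ^ ((c + t) * i) * 2 ^ (c * t)           ≡⟨ ^-distribˡ-+-* 2 ((c + t) * i) (c * t) ⟨
  2 ^ ((c + t) * i + c * t)                 ≡⟨ cong (2 ^_) (solve 3 (λ c t i → (c :+ t) :* i :+ c :* t := c :* i :+ (c :+ i) :* t) refl c t i) ⟩
  2 ^ (c * i + (c + i) * t)                 ≡⟨ ^-distribˡ-+-* 2 (c * i) ((c + i) * t) ⟩
  2 ^ (c * i) * exp2 (c + i) t              ∎
  where open ≤-Reasoning

E-step : ∀ (n : ℕ → ℕ) → (∀ t → t ≤ n t) → ∀ j → (λ t → E (n t) j) ≲ (λ t → E (n t) (suc j))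
E-step n t≤n j = 2 , suc (2 * j) , λ t t≥ → linPow-mono 2 (n t) j (≤-trans t≥ (t≤n t))

Superadditive : (ℕ → ℕ) → Set
Superadditive φ = ∀ i j → φ i + φ j ≤ φ (i + j)

^^-≲-exp2 : ∀ φ → Superadditive φ → (F : GF) → (∀ j → (λ t → F t j) ≲ exp2 (φ j)) →
            ∀ n k → (λ t → (F t ^^ n) k) ≲ exp2 (φ k)
^^-≲-exp2 φ sup F F≲ zero    zero    = ≤⇒≲ (λ t → m^n>0 2 (φ 0 * t))
^^-≲-exp2 φ sup F F≲ zero    (suc k) = ≤⇒≲ (λ t → z≤n)
^^-≲-exp2 φ sup F F≲ (suc n) k       = ≲-sumTo-lub k (λ i i≤k →
  ≲-trans (≲-* (F≲ i) (^^-≲-exp2 φ sup F F≲ n (k ∸ i))) (≤⇒≲ (combine i≤k)))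
  where
  combine : ∀ {i} → i ≤ k → ∀ t → exp2 (φ i) t * exp2 (φ (k ∸ i)) t ≤ exp2 (φ k) t
  combine {i} i≤k t = begin
    exp2 (φ i) t * exp2 (φ (k ∸ i)) t  ≡⟨ exp2-+ (φ i) (φ (k ∸ i)) t ⟩
    exp2 (φ i + φ (k ∸ i)) t           ≤⟨ exp2-mono t (sup i (k ∸ i)) ⟩
    exp2 (φ (i + (k ∸ i))) t           ≡⟨ cong (λ j → exp2 (φ j) t) (m+[n∸m]≡n i≤k) ⟩
    exp2 (φ k) t                       ∎
    where open ≤-Reasoning

^^-suc-≥ : ∀ (f : Series) n k {i} → i ≤ k → f i * (f ^^ n) (k ∸ i) ≤ (f ^^ suc n) k
^^-suc-≥ f n k i≤k = ≤-sumTo k (λ i → f i * (f ^^ n) (k ∸ i)) i≤k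

exp2-≲-^^ : (F : GF) → (λ _ → 1) ≲ (λ t → F t 0) → exp2 1 ≲ (λ t → F t 1) →
            ∀ n k → k ≤ n → exp2 k ≲ (λ t → (F t ^^ n) k)
exp2-≲-^^ F 1≲F₀ 2^t≲F₁ zero    zero    _         = ≲-refl
exp2-≲-^^ F 1≲F₀ 2^t≲F₁ (suc n) zero    _         = ≲-* 1≲F₀ (exp2-≲-^^ F 1≲F₀ 2^t≲F₁ n zero z≤n)
exp2-≲-^^ F 1≲F₀ 2^t≲F₁ (suc n) (suc k) (s≤s k≤n) =
  ≲-trans (≤⇒≲ (λ t → ≤-reflexive (sym (exp2-+ 1 k t))))
  (≲-trans (≲-* 2^t≲F₁ (exp2-≲-^^ F 1≲F₀ 2^t≲F₁ n k k≤n))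
           (≤⇒≲ (λ t → ^^-suc-≥ (F t) n (suc k) (s≤s (z≤n {k})))))

φ₂ : ℕ → ℕ
φ₂ k = k + k / 2

φ₂-+2 : ∀ k → φ₂ (suc (suc k)) ≡ 3 + φ₂ k
φ₂-+2 k = trans (cong (suc (suc k) +_) (half-+2 k))
                (solve 2 (λ k h → (con 2 :+ k) :+ (con 1 :+ h) := con 3 :+ (k :+ h)) refl k (k / 2))
  where
  half-+2 : ∀ k → suc (suc k) / 2 ≡ suc (k / 2)
  half-+2 k = m/n≡1+[m∸n]/n {suc (suc k)} {2} (s≤s (s≤s z≤n))

φ₂-superadditive : Superadditive φ₂
φ₂-superadditive i j = begin
  (i + i / 2) + (j + j / 2)   ≡⟨ solve 4 (λ i a j b → (i :+ a) :+ (j :+ b) := (i :+ j) :+ (a :+ b)) refl i (i / 2) j (j / 2) ⟩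
  (i + j) + (i / 2 + j / 2)   ≤⟨ +-monoʳ-≤ (i + j) (half-superadditive i j) ⟩
  (i + j) + (i + j) / 2       ∎
  where
  open ≤-Reasoning
  half-superadditive : ∀ i j → i / 2 + j / 2 ≤ (i + j) / 2
  half-superadditive zero          j = ≤-refl
  half-superadditive (suc zero)    j = /-monoˡ-≤ 2 (n≤1+n j)
  half-superadditive (suc (suc i)) j = begin
    suc (suc i) / 2 + j / 2   ≡⟨ cong (_+ j / 2) (m/n≡1+[m∸n]/n {suc (suc i)} {2} (s≤s (s≤s z≤n))) ⟩
    suc (i / 2 + j / 2)       ≤⟨ s≤s (half-superadditive i j) ⟩
    suc ((i + j) / 2)         ≡⟨ m/n≡1+[m∸n]/n {suc (suc (i + j))} {2} (s≤s (s≤s z≤n)) ⟨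
    (suc (suc i) + j) / 2     ∎

φ₂-mono : ∀ j → φ₂ j ≤ φ₂ (suc j)
φ₂-mono j = +-mono-≤ (n≤1+n j) (/-monoˡ-≤ 2 (n≤1+n j))

exp2φ₂-≲-^^ : (F : GF) → (λ _ → 1) ≲ (λ t → F t 0) → exp2 1 ≲ (λ t → F t 1) → exp2 3 ≲ (λ t → F t 2) →
              ∀ n k → k ≤ 2 * n → exp2 (φ₂ k) ≲ (λ t → (F t ^^ n) k)
exp2φ₂-≲-^^ F 1≲F₀ 2^t≲F₁ 2^3t≲F₂ zero    zero          _ = ≲-refl
exp2φ₂-≲-^^ F 1≲F₀ 2^t≲F₁ 2^3t≲F₂ (suc n) zero          _ =
  ≲-* 1≲F₀ (exp2φ₂-≲-^^ F 1≲F₀ 2^t≲F₁ 2^3t≲F₂ n zero z≤n)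
exp2φ₂-≲-^^ F 1≲F₀ 2^t≲F₁ 2^3t≲F₂ (suc n) (suc zero)    _ =
  ≲-trans (≤⇒≲ (λ t → ≤-reflexive (sym (exp2-+ 1 0 t))))
  (≲-trans (≲-* 2^t≲F₁ (exp2φ₂-≲-^^ F 1≲F₀ 2^t≲F₁ 2^3t≲F₂ n zero z≤n))
           (≤⇒≲ (λ t → ^^-suc-≥ (F t) n 1 ≤-refl)))
exp2φ₂-≲-^^ F 1≲F₀ 2^t≲F₁ 2^3t≲F₂ (suc n) (suc (suc k)) k+2≤2n+2 =
  ≲-trans (≤⇒≲ (λ t → ≤-reflexive (trans (cong (λ e → exp2 e t) (φ₂-+2 k)) (sym (exp2-+ 3 (φ₂ k) t)))))
  (≲-trans (≲-* 2^3t≲F₂ (exp2φ₂-≲-^^ F 1≲F₀ 2^t≲F₁ 2^3t≲F₂ n k k≤2n))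
           (≤⇒≲ (λ t → ^^-suc-≥ (F t) n (suc (suc k)) (s≤s (s≤s (z≤n {k}))))))
  where
  k≤2n : k ≤ 2 * n
  k≤2n = ≤-pred (≤-pred (subst (suc (suc k) ≤_) (*-suc 2 n) k+2≤2n+2))

linMul-1+x-≋ : ∀ M (F : GF) → (∀ j → suc j < M → (λ t → F t j) ≲ (λ t → F t (suc j))) →
               (λ t → linMul 1 1 (F t)) ≋[ M ] F
linMul-1+x-≋ M F step zero    _     = ≗⇒≋ (λ t → *-identityˡ (F t 0))
linMul-1+x-≋ M F step (suc j) j+1<M =
  ≲-lub (≤⇒≲ (λ t → ≤-reflexive (*-identityˡ (F t (suc j)))))
        (≲-trans (≤⇒≲ (λ t → ≤-reflexive (*-identityˡ (F t j)))) (step j j+1<M)) ,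
  ≤⇒≲ (λ t → ≤-trans (≤-reflexive (sym (*-identityˡ (F t (suc j))))) (m≤m+n _ _))

-- The eight estimates

E≋2^t·binomial : ∀ M → E ≋[ M ] (λ t → scale (2 ^ t) (binomial t))
E≋2^t·binomial M k _ = ≋-trans (≋-sym (≋-*ˡ (2 ^ k) (m^n>0 2 k))) (≗⇒≋ (λ t → linPow-binomial 2 t k))

pow-2+x-≋ : ∀ M → (λ t → (cst 2 ⊕ X) ^^ t) ≋[ M ] (λ t → cst (2 ^ t) ⊛ (cst 1 ⊕ X) ^^ t)
pow-2+x-≋ M = begin
  (λ t → (cst 2 ⊕ X) ^^ t)                    ≈⟨ ≗⇒≋[] (monic-lin-^^ 2) ⟩
  E                                           ≈⟨ E≋2^t·binomial M ⟩
  (λ t → scale (2 ^ t) (binomial t))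
    ≈⟨ ≗⇒≋[] (λ t → ≗-trans (cst-⊛ (2 ^ t) _) (λ k → cong (2 ^ t *_) (monic-lin-^^ 1 t k))) ⟨
  (λ t → cst (2 ^ t) ⊛ (cst 1 ⊕ X) ^^ t)      ∎
  where open ≋-Reasoning M

pow-2+x-absorbs-1+x : ∀ M → (λ t → (cst 2 ⊕ X) ^^ t ⊛ (cst 1 ⊕ X)) ≋[ M ] (λ t → (cst 2 ⊕ X) ^^ t)
pow-2+x-absorbs-1+x M = begin
  (λ t → (cst 2 ⊕ X) ^^ t ⊛ (cst 1 ⊕ X))  ≈⟨ ≗⇒≋[] (λ t → ≗-trans (⊛-congˡ (cst 1 ⊕ X) (monic-lin-^^ 2 t)) (⊛-1+x (E t))) ⟩
  (λ t → linMul 1 1 (E t))                ≈⟨ linMul-1+x-≋ M E (λ j _ → E-step (λ t → t) (λ t → ≤-refl) j) ⟩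
  E                                       ≈⟨ ≗⇒≋[] (monic-lin-^^ 2) ⟨
  (λ t → (cst 2 ⊕ X) ^^ t)                ∎
  where open ≋-Reasoning M

linPow-2^t-step : ∀ m j → suc j ≤ m → (λ t → linPow 1 (2 ^ t) m j) ≲ (λ t → linPow 1 (2 ^ t) m (suc j))
linPow-2^t-step m j j<m = binomial m j , 0 , λ t _ → begin
  linPow 1 (2 ^ t) m j                                     ≡⟨ linPow-scale (2 ^ t) m j ⟩
  binomial m j * (2 ^ t) ^ j                               ≤⟨ *-monoʳ-≤ (binomial m j) (m≤n*m _ (2 ^ t) {{m^n≢0 2 t}}) ⟩
  binomial m j * (2 ^ t) ^ suc j
    ≤⟨ *-monoʳ-≤ (binomial m j) (m≤n*m _ (binomial m (suc j)) {{>-nonZero (binomial-pos m (suc j) j<m)}}) ⟩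
  binomial m j * (binomial m (suc j) * (2 ^ t) ^ suc j)    ≡⟨ cong (binomial m j *_) (linPow-scale (2 ^ t) m (suc j)) ⟨
  binomial m j * linPow 1 (2 ^ t) m (suc j)                ∎
  where open ≤-Reasoning

pow-1+2^tx-absorbs-1+x : ∀ m → (λ t → (cst 1 ⊕ cst (2 ^ t) ⊛ X) ^^ m ⊛ (cst 1 ⊕ X))
                                ≋[ m + 1 ] (λ t → (cst 1 ⊕ cst (2 ^ t) ⊛ X) ^^ m)
pow-1+2^tx-absorbs-1+x m = begin
  (λ t → (cst 1 ⊕ cst (2 ^ t) ⊛ X) ^^ m ⊛ (cst 1 ⊕ X))
    ≈⟨ ≗⇒≋[] (λ t → ≗-trans (⊛-congˡ (cst 1 ⊕ X) (lin-^^ 1 (2 ^ t) m)) (⊛-1+x (linPow 1 (2 ^ t) m))) ⟩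
  (λ t → linMul 1 1 (linPow 1 (2 ^ t) m))
    ≈⟨ linMul-1+x-≋ (m + 1) (λ t → linPow 1 (2 ^ t) m)
                    (λ j j+1<m+1 → linPow-2^t-step m j (≤-pred (subst (suc (suc j) ≤_) (+-comm m 1) j+1<m+1))) ⟩
  (λ t → linPow 1 (2 ^ t) m)
    ≈⟨ ≗⇒≋[] (λ t → lin-^^ 1 (2 ^ t) m) ⟨
  (λ t → (cst 1 ⊕ cst (2 ^ t) ⊛ X) ^^ m) ∎
  where open ≋-Reasoning (m + 1)

H : ℕ → Series
H t = cst 1 ⊕ shift (E t)

polyRS2≋H : ∀ M → polyRS2 ≋[ M ] H
polyRS2≋H M zero    _ = ≗⇒≋ polyRS2-constant
polyRS2≋H M (suc j) _ =
  (suc (2 ^ j) , 0 , λ t _ → begin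
    binomial t (suc j) + E t j   ≤⟨ +-monoˡ-≤ (E t j) (binomial-suc≤E t j) ⟩
    2 ^ j * E t j + E t j        ≡⟨ +-comm (2 ^ j * E t j) (E t j) ⟩
    suc (2 ^ j) * E t j          ∎) ,
  ≤⇒≲ (λ t → m≤n+m (E t j) (binomial t (suc j)))
  where open ≤-Reasoning

RI-S2-≋ : ∀ M → (λ t → RI (S2 t)) ≋[ M ] (λ t → cst 1 ⊕ cst (2 ^ t) ⊛ X ⊛ (cst 1 ⊕ X) ^^ t)
RI-S2-≋ M = begin
  (λ t → RI (S2 t))                                    ≈⟨ ≗⇒≋[] RI-S2 ⟩
  polyRS2                                              ≈⟨ polyRS2≋H M ⟩
  H                                                    ≈⟨ ≋[]-⊕ ≋[]-refl (≋[]-shift (E≋2^t·binomial M)) ⟩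
  (λ t → cst 1 ⊕ shift (scale (2 ^ t) (binomial t)))   ≈⟨ ≗⇒≋[] (λ t → ⊕-cong {cst 1} ≗-refl (target t)) ⟨
  (λ t → cst 1 ⊕ cst (2 ^ t) ⊛ X ⊛ (cst 1 ⊕ X) ^^ t)   ∎
  where
  open ≋-Reasoning M
  target : ∀ t → cst (2 ^ t) ⊛ X ⊛ (cst 1 ⊕ X) ^^ t ≗ shift (scale (2 ^ t) (binomial t))
  target t = ≗-trans (cst-X-⊛ (2 ^ t) _) (shift-cong (λ k → cong (2 ^ t *_) (monic-lin-^^ 1 t k)))

-- H t ^ 3 = 1 + 3 x E t + 3 x ^ 2 E (2t) + x ^ 3 E (3t)
cubeH : ℕ → Series
cubeH t zero                = 1
cubeH t (suc zero)          = 3 * E t 0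
cubeH t (suc (suc zero))    = 3 * E t 1 + 3 * E (t + t) 0
cubeH t (suc (suc (suc k))) = 3 * E t (suc (suc k)) + 3 * E (t + t) (suc k) + E (3 * t) k

H-⊛ : ∀ t g → H t ⊛ g ≗ g ⊕ shift (E t ⊛ g)
H-⊛ t g = ≗-trans (⊛-distribʳ-⊕ g (cst 1) (shift (E t))) (⊕-cong (⊛-identityˡ g) (shift-⊛ (E t) g))

E-⊛-shift : ∀ m n → E m ⊛ shift (E n) ≗ shift (E (m + n))
E-⊛-shift m n = ≗-trans (⊛-shiftʳ (E m) (E n)) (shift-cong (linPow-+ 2 1 m n))

t+[t+t]≡3*t : ∀ t → t + (t + t) ≡ 3 * t
t+[t+t]≡3*t t = cong (λ n → t + (t + n)) (sym (+-identityʳ t))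

H-cube : ∀ t → H t ^^ 3 ≗ cubeH t
H-cube t = begin
  H t ⊛ (H t ⊛ (H t ⊛ cst 1))        ≈⟨ ⊛-congʳ (H t) (⊛-congʳ (H t) (⊛-identityʳ (H t))) ⟩
  H t ⊛ (H t ⊛ H t)                  ≈⟨ ⊛-congʳ (H t) (≗-trans (H-⊛ t (H t)) (⊕-cong {H t} ≗-refl (shift-cong E⊛H))) ⟩
  H t ⊛ H²                           ≈⟨ H-⊛ t H² ⟩
  H² ⊕ shift (E t ⊛ H²)              ≈⟨ ⊕-cong {H²} ≗-refl (shift-cong E⊛H²) ⟩
  H² ⊕ shift ((E t ⊕ shift E₂) ⊕ shift (E₂ ⊕ shift E₃)) ≈⟨ collect ⟩
  cubeH t                            ∎
  where
  open ≗-Reasoning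
  E₂ = E (t + t)
  E₃ = E (t + (t + t))
  H² = H t ⊕ shift (E t ⊕ shift E₂)
  E⊛H : E t ⊛ H t ≗ E t ⊕ shift E₂
  E⊛H = ≗-trans (⊛-distribˡ-⊕ (E t) (cst 1) (shift (E t))) (⊕-cong (⊛-identityʳ (E t)) (E-⊛-shift t t))
  E⊛H² : E t ⊛ H² ≗ (E t ⊕ shift E₂) ⊕ shift (E₂ ⊕ shift E₃)
  E⊛H² = begin
    E t ⊛ H²                                       ≈⟨ ⊛-distribˡ-⊕ (E t) (H t) (shift (E t ⊕ shift E₂)) ⟩
    E t ⊛ H t ⊕ E t ⊛ shift (E t ⊕ shift E₂)       ≈⟨ ⊕-cong E⊛H (⊛-shiftʳ (E t) (E t ⊕ shift E₂)) ⟩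
    (E t ⊕ shift E₂) ⊕ shift (E t ⊛ (E t ⊕ shift E₂))
      ≈⟨ ⊕-cong {E t ⊕ shift E₂} ≗-refl (shift-cong (≗-trans (⊛-distribˡ-⊕ (E t) (E t) (shift E₂))
                                                             (⊕-cong (linPow-+ 2 1 t t) (E-⊛-shift t (t + t))))) ⟩
    (E t ⊕ shift E₂) ⊕ shift (E₂ ⊕ shift E₃)       ∎
  collect : H² ⊕ shift ((E t ⊕ shift E₂) ⊕ shift (E₂ ⊕ shift E₃)) ≗ cubeH t
  collect zero                = refl
  collect (suc zero)          = solve 1 (λ e → ((con 0 :+ e) :+ (e :+ con 0)) :+ ((e :+ con 0) :+ con 0) := con 3 :* e) refl (E t 0)
  collect (suc (suc zero))    =
    solve 2 (λ e f → ((con 0 :+ e) :+ (e :+ f)) :+ ((e :+ f) :+ (f :+ con 0)) := con 3 :* e :+ con 3 :* f)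
            refl (E t 1) (E₂ 0)
  collect (suc (suc (suc k))) = trans
    (solve 3 (λ e f g → ((con 0 :+ e) :+ (e :+ f)) :+ ((e :+ f) :+ (f :+ g)) := con 3 :* e :+ con 3 :* f :+ g)
             refl (E t (suc (suc k))) (E₂ (suc k)) (E₃ k))
                                      (cong (λ n → 3 * E t (suc (suc k)) + 3 * E₂ (suc k) + E n k) (t+[t+t]≡3*t t))

Q : ℕ → ℕ → Series
Q j t = linPow 1 (2 ^ t) 2 ⊕ shiftN j (E (3 * t))

Q-≗ : ∀ j t → (cst 1 ⊕ cst (2 ^ t) ⊛ X) ^^ 2 ⊕ X ^^ j ⊛ (cst 2 ⊕ X) ^^ (3 * t) ≗ Q j t
Q-≗ j t = ⊕-cong (lin-^^ 1 (2 ^ t) 2) (≗-trans (⊛-congʳ (X ^^ j) (monic-lin-^^ 2 (3 * t))) (X^^-⊛ j _))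

Q-tail : ∀ j t i → Q j t (3 + i) ≡ shiftN j (E (3 * t)) (3 + i)
Q-tail j t i = cong (_+ shiftN j (E (3 * t)) (3 + i)) (linPow-vanish 1 (2 ^ t) 2 (s≤s (s≤s (s≤s (z≤n {i})))))

sq-linear : ∀ r → linPow 1 r 2 1 ≡ 2 * r
sq-linear r = solve 1 (λ r → con 1 :* (con 1 :* con 0 :+ r :* con 1) :+ r :* (con 1 :* con 1) := con 2 :* r) refl r

sq-quadratic : ∀ r → linPow 1 r 2 2 ≡ r * r
sq-quadratic r = solve 1 (λ r → con 1 :* (con 1 :* con 0 :+ r :* con 0) :+ r :* (con 1 :* con 0 :+ r :* con 1) := r :* r) refl r

E-suc-suc≤E₃ : ∀ t j → E t (suc (suc j)) ≤ E (3 * t) j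
E-suc-suc≤E₃ t j = begin
  E t (suc (suc j))          ≤⟨ linPow-suc≤ 2 t (suc j) ⟩
  t * E t (suc j)            ≤⟨ *-monoʳ-≤ t (linPow-suc≤ 2 t j) ⟩
  t * (t * E t j)            ≤⟨ *-mono-≤ (n≤2^n t) (*-monoˡ-≤ (E t j) (n≤2^n t)) ⟩
  2 ^ t * (2 ^ t * E t j)    ≡⟨ *-assoc (2 ^ t) (2 ^ t) (E t j) ⟨
  2 ^ t * 2 ^ t * E t j      ≡⟨ cong (_* E t j) (^-distribˡ-+-* 2 t t) ⟨
  2 ^ (t + t) * E t j        ≤⟨ E-+-≥ (t + t) t j ⟩
  E (t + t + t) j            ≡⟨ cong (λ n → E n j) (trans (+-assoc t t t) (t+[t+t]≡3*t t)) ⟩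
  E (3 * t) j                ∎
  where open ≤-Reasoning

E₂-suc≤E₃ : ∀ t j → E (t + t) (suc j) ≤ 2 * E (3 * t) j
E₂-suc≤E₃ t j = begin
  E (t + t) (suc j)               ≤⟨ linPow-suc≤ 2 (t + t) j ⟩
  (t + t) * E (t + t) j           ≤⟨ *-monoˡ-≤ (E (t + t) j) (+-mono-≤ (n≤2^n t) (n≤2^n t)) ⟩
  (2 ^ t + 2 ^ t) * E (t + t) j   ≡⟨ solve 2 (λ r e → (r :+ r) :* e := con 2 :* (r :* e)) refl (2 ^ t) (E (t + t) j) ⟩
  2 * (2 ^ t * E (t + t) j)       ≤⟨ *-monoʳ-≤ 2 (E-+-≥ t (t + t) j) ⟩
  2 * E (t + (t + t)) j           ≡⟨ cong (λ n → 2 * E n j) (t+[t+t]≡3*t t) ⟩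
  2 * E (3 * t) j                 ∎
  where open ≤-Reasoning

cubeH≋Q₃ : ∀ M → cubeH ≋[ M ] Q 3
cubeH≋Q₃ M zero                _ = ≋-refl
cubeH≋Q₃ M (suc zero)          _ =
  ≋-trans (≗⇒≋ (λ t → cong (3 *_) (E-constant t)))
  (≋-trans (≋-*ˡ {λ t → 2 ^ t} 3 (s≤s z≤n))
  (≋-trans (≋-sym (≋-*ˡ {λ t → 2 ^ t} 2 (s≤s z≤n)))
           (≗⇒≋ (λ t → sym (trans (+-identityʳ _) (sq-linear (2 ^ t)))))))
cubeH≋Q₃ M (suc (suc zero))    _ =
  (6 , 0 , λ t _ → begin
    3 * E t 1 + 3 * E (t + t) 0         ≤⟨ +-mono-≤ (*-monoʳ-≤ 3 (E₁≤ t)) (*-monoʳ-≤ 3 (≤-reflexive (E₂₀ t))) ⟩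
    3 * (2 ^ t * 2 ^ t) + 3 * (2 ^ t * 2 ^ t)
                                        ≡⟨ solve 1 (λ q → con 3 :* q :+ con 3 :* q := con 6 :* q) refl (2 ^ t * 2 ^ t) ⟩
    6 * (2 ^ t * 2 ^ t)                 ≡⟨ cong (6 *_) (trans (sym (sq-quadratic (2 ^ t))) (sym (+-identityʳ _))) ⟩
    6 * Q 3 t 2                         ∎) ,
  ≤⇒≲ (λ t → begin
    Q 3 t 2                             ≡⟨ trans (+-identityʳ _) (sq-quadratic (2 ^ t)) ⟩
    2 ^ t * 2 ^ t                       ≡⟨ E₂₀ t ⟨
    E (t + t) 0                         ≤⟨ m≤n*m (E (t + t) 0) 3 ⟩
    3 * E (t + t) 0                     ≤⟨ m≤n+m _ (3 * E t 1) ⟩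
    3 * E t 1 + 3 * E (t + t) 0         ∎)
  where
  open ≤-Reasoning
  E₂₀ : ∀ t → E (t + t) 0 ≡ 2 ^ t * 2 ^ t
  E₂₀ t = trans (E-constant (t + t)) (^-distribˡ-+-* 2 t t)
  E₁≤ : ∀ t → E t 1 ≤ 2 ^ t * 2 ^ t
  E₁≤ t = ≤-trans (linPow-suc≤ 2 t 0) (*-mono-≤ (n≤2^n t) (≤-reflexive (E-constant t)))
cubeH≋Q₃ M (suc (suc (suc j))) _ =
  (10 , 0 , λ t _ → begin
    3 * E t (suc (suc j)) + 3 * E (t + t) (suc j) + E (3 * t) j
      ≤⟨ +-monoˡ-≤ (E (3 * t) j) (+-mono-≤ (*-monoʳ-≤ 3 (E-suc-suc≤E₃ t j)) (*-monoʳ-≤ 3 (E₂-suc≤E₃ t j))) ⟩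
    3 * E (3 * t) j + 3 * (2 * E (3 * t) j) + E (3 * t) j
      ≡⟨ solve 1 (λ e → con 3 :* e :+ con 3 :* (con 2 :* e) :+ e := con 10 :* e) refl (E (3 * t) j) ⟩
    10 * E (3 * t) j
      ≡⟨ cong (10 *_) (Q-tail 3 t j) ⟨
    10 * Q 3 t (suc (suc (suc j))) ∎) ,
  ≤⇒≲ (λ t → begin
    Q 3 t (suc (suc (suc j)))   ≡⟨ Q-tail 3 t j ⟩
    E (3 * t) j                 ≤⟨ m≤n+m _ _ ⟩
    3 * E t (suc (suc j)) + 3 * E (t + t) (suc j) + E (3 * t) j ∎)
  where open ≤-Reasoning

polyRS2-cube-≋ : ∀ M → (λ t → polyRS2 t ^^ 3) ≋[ M ] Q 3
polyRS2-cube-≋ M = begin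
  (λ t → polyRS2 t ^^ 3)   ≈⟨ ≋[]-^^ 3 (polyRS2≋H M) ⟩
  (λ t → H t ^^ 3)         ≈⟨ ≗⇒≋[] H-cube ⟩
  cubeH                    ≈⟨ cubeH≋Q₃ M ⟩
  Q 3                      ∎
  where open ≋-Reasoning M

RI-S2-cube-≋ : ∀ M → (λ t → RI (S2 t) ^^ 3) ≋[ M ] (λ t → (cst 1 ⊕ cst (2 ^ t) ⊛ X) ^^ 2 ⊕ X ^^ 3 ⊛ (cst 2 ⊕ X) ^^ (3 * t))
RI-S2-cube-≋ M = begin
  (λ t → RI (S2 t) ^^ 3)   ≈⟨ ≗⇒≋[] (λ t → ^^-cong 3 (RI-S2 t)) ⟩
  (λ t → polyRS2 t ^^ 3)   ≈⟨ polyRS2-cube-≋ M ⟩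
  Q 3                      ≈⟨ ≗⇒≋[] (Q-≗ 3) ⟨
  (λ t → (cst 1 ⊕ cst (2 ^ t) ⊛ X) ^^ 2 ⊕ X ^^ 3 ⊛ (cst 2 ⊕ X) ^^ (3 * t)) ∎
  where open ≋-Reasoning M

-- x ^ 3 E (3t) + x ^ 2 E (3t) = x ^ 2 (1 + x) E (3t) ≋ x ^ 2 E (3t)
RI-T3-≋Q₂ : ∀ M → (λ t → RI (T3 t)) ≋[ M ] Q 2
RI-T3-≋Q₂ M = begin
  (λ t → RI (T3 t))                                                     ≈⟨ ≗⇒≋[] RI-T3 ⟩
  polyRT3                                                               ≈⟨ ≋[]-⊕ (polyRS2-cube-≋ M) ≋[]-refl ⟩
  (λ t → Q 3 t ⊕ shift (shift (E (3 * t))))                             ≈⟨ ≗⇒≋[] regroup ⟩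
  (λ t → linPow 1 (2 ^ t) 2 ⊕ shift (shift (linMul 1 1 (E (3 * t)))))  ≈⟨ ≋[]-⊕ ≋[]-refl (≋[]-shift (≋[]-shift absorb)) ⟩
  Q 2                                                                   ∎
  where
  open ≋-Reasoning M
  absorb : (λ t → linMul 1 1 (E (3 * t))) ≋[ M ] (λ t → E (3 * t))
  absorb = linMul-1+x-≋ M (λ t → E (3 * t)) (λ j _ → E-step (3 *_) (λ t → m≤m+n t _) j)
  regroup : ∀ t → Q 3 t ⊕ shift (shift (E (3 * t))) ≗ linPow 1 (2 ^ t) 2 ⊕ shift (shift (linMul 1 1 (E (3 * t))))
  regroup t k = trans (+-assoc (linPow 1 (2 ^ t) 2 k) _ _) (cong (linPow 1 (2 ^ t) 2 k +_) (shifts k))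
    where
    e = E (3 * t)
    shifts : shift (shift (shift e)) ⊕ shift (shift e) ≗ shift (shift (linMul 1 1 e))
    shifts = ≗-trans (shift-⊕ _ _) (shift-cong (≗-trans (shift-⊕ _ _) (shift-cong (shift-⊕-linMul e))))

RI-T3-≋ : ∀ M → (λ t → RI (T3 t)) ≋[ M ] (λ t → (cst 1 ⊕ cst (2 ^ t) ⊛ X) ^^ 2 ⊕ X ^^ 2 ⊛ (cst 2 ⊕ X) ^^ (3 * t))
RI-T3-≋ M = begin
  (λ t → RI (T3 t))   ≈⟨ RI-T3-≋Q₂ M ⟩
  Q 2                 ≈⟨ ≗⇒≋[] (Q-≗ 2) ⟨
  (λ t → (cst 1 ⊕ cst (2 ^ t) ⊛ X) ^^ 2 ⊕ X ^^ 2 ⊛ (cst 2 ⊕ X) ^^ (3 * t)) ∎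
  where open ≋-Reasoning M

Q₂-coefficient-≲ : ∀ j → (λ t → Q 2 t j) ≲ exp2 (φ₂ j)
Q₂-coefficient-≲ zero                = ≲-refl
Q₂-coefficient-≲ (suc zero)          = 2 , 0 , λ t _ →
  ≤-reflexive (trans (+-identityʳ _) (trans (sq-linear (2 ^ t)) (cong (λ n → 2 * 2 ^ n) (sym (+-identityʳ t)))))
Q₂-coefficient-≲ (suc (suc zero))    = 2 , 0 , λ t _ → begin
  linPow 1 (2 ^ t) 2 2 + E (3 * t) 0    ≡⟨ cong₂ _+_ (sq-quadratic (2 ^ t)) (E-constant (3 * t)) ⟩
  2 ^ t * 2 ^ t + 2 ^ (3 * t)           ≡⟨ cong (_+ 2 ^ (3 * t)) (^-distribˡ-+-* 2 t t) ⟨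
  2 ^ (t + t) + 2 ^ (3 * t)             ≤⟨ +-monoˡ-≤ (2 ^ (3 * t)) (^-monoʳ-≤ 2 (+-monoʳ-≤ t (m≤m+n t (t + 0)))) ⟩
  2 ^ (3 * t) + 2 ^ (3 * t)             ≡⟨ cong (2 ^ (3 * t) +_) (+-identityʳ _) ⟨
  2 * exp2 3 t                          ∎
  where open ≤-Reasoning
Q₂-coefficient-≲ (suc (suc (suc i))) =
  ≲-trans (≤⇒≲ (λ t → ≤-reflexive (Q-tail 2 t i)))
  (≲-trans (E-growth 3 (suc i)) (≤⇒≲ (λ t → exp2-mono t 4+i≤φ₂)))
  where
  4+i≤φ₂ : 3 + suc i ≤ φ₂ (3 + i)
  4+i≤φ₂ = ≤-trans (≤-reflexive (+-comm 1 (3 + i))) (+-monoʳ-≤ (3 + i) (/-monoˡ-≤ 2 (s≤s (s≤s (z≤n {suc i})))))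

Q₂-pow-≋ : ∀ m k → k ≤ 2 * m → (λ t → (Q 2 t ^^ m) k) ≋ exp2 (φ₂ k)
Q₂-pow-≋ m k k≤2m =
  ^^-≲-exp2 φ₂ φ₂-superadditive (Q 2) Q₂-coefficient-≲ m k ,
  exp2φ₂-≲-^^ (Q 2) ≲-refl Q₂₁ Q₂₂ m k k≤2m
  where
  Q₂₁ : exp2 1 ≲ (λ t → Q 2 t 1)
  Q₂₁ = ≤⇒≲ (λ t → begin
    exp2 1 t             ≡⟨ cong (2 ^_) (+-identityʳ t) ⟩
    2 ^ t                ≤⟨ m≤m+n (2 ^ t) (2 ^ t + 0) ⟩
    2 * 2 ^ t            ≡⟨ trans (+-identityʳ _) (sq-linear (2 ^ t)) ⟨
    Q 2 t 1              ∎)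
    where open ≤-Reasoning
  Q₂₂ : exp2 3 ≲ (λ t → Q 2 t 2)
  Q₂₂ = ≤⇒≲ (λ t → ≤-trans (≤-reflexive (sym (E-constant (3 * t)))) (m≤n+m _ _))

RI-T3-pow-≋ : ∀ m → (λ t → RI (T3 t) ^^ m ⊛ (X ⊕ cst 1)) ≋[ 2 * m + 1 ] (λ t k → 2 ^ ((k + k / 2) * t))
RI-T3-pow-≋ m = begin
  (λ t → RI (T3 t) ^^ m ⊛ (X ⊕ cst 1))  ≈⟨ ≋[]-⊛ (≋[]-^^ m (RI-T3-≋Q₂ M)) (≋[]-refl {F = λ _ → X ⊕ cst 1}) ⟩
  (λ t → Q 2 t ^^ m ⊛ (X ⊕ cst 1))
    ≈⟨ ≗⇒≋[] (λ t → ≗-trans (⊛-congʳ (Q 2 t ^^ m) (λ k → +-comm (X k) (cst 1 k))) (⊛-1+x _)) ⟩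
  (λ t → linMul 1 1 (Q 2 t ^^ m))       ≈⟨ linMul-1+x-≋ M (λ t → Q 2 t ^^ m) step ⟩
  (λ t → Q 2 t ^^ m)                    ≈⟨ (λ k k<M → Q₂-pow-≋ m k (below k<M)) ⟩
  (λ t k → exp2 (φ₂ k) t)               ∎
  where
  M = 2 * m + 1
  open ≋-Reasoning M
  below : ∀ {k} → k < M → k ≤ 2 * m
  below {k} k<M = ≤-pred (subst (suc k ≤_) (+-comm (2 * m) 1) k<M)
  step : ∀ j → suc j < M → (λ t → (Q 2 t ^^ m) j) ≲ (λ t → (Q 2 t ^^ m) (suc j))
  step j j+1<M = ≲-trans (proj₁ (Q₂-pow-≋ m j (≤-trans (n≤1+n j) (below j+1<M))))
                 (≲-trans (≤⇒≲ (λ t → exp2-mono t (φ₂-mono j)))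
                          (proj₂ (Q₂-pow-≋ m (suc j) (below j+1<M))))

H-coefficient-≲ : ∀ j → (λ t → H t j) ≲ exp2 j
H-coefficient-≲ zero    = ≲-refl
H-coefficient-≲ (suc j) = ≲-trans (≤⇒≲ (λ t → ≤-reflexive (cong (λ n → E n j) (sym (*-identityˡ t))))) (E-growth 1 j)

H-pow-≋ : ∀ n k → k ≤ n → (λ t → (H t ^^ n) k) ≋ exp2 k
H-pow-≋ n k k≤n =
  ^^-≲-exp2 (λ k → k) (λ i j → ≤-refl) H H-coefficient-≲ n k ,
  exp2-≲-^^ H ≲-refl (≤⇒≲ (λ t → ≤-reflexive (trans (cong (2 ^_) (+-identityʳ t)) (sym (E-constant t))))) n k k≤n

RI-S2-pow-≋ : ∀ m → (λ t → RI (S2 t) ^^ (3 * m)) ≋[ 2 * m + 1 ] (λ t k → 2 ^ (k * t))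
RI-S2-pow-≋ m = begin
  (λ t → RI (S2 t) ^^ (3 * m))     ≈⟨ ≗⇒≋[] (λ t → ^^-cong (3 * m) (RI-S2 t)) ⟩
  (λ t → polyRS2 t ^^ (3 * m))     ≈⟨ ≋[]-^^ (3 * m) (polyRS2≋H M) ⟩
  (λ t → H t ^^ (3 * m))           ≈⟨ (λ k k<M → H-pow-≋ (3 * m) k (below k<M)) ⟩
  (λ t k → exp2 k t)               ∎
  where
  M = 2 * m + 1
  open ≋-Reasoning M
  below : ∀ {k} → k < M → k ≤ 3 * m
  below {k} k<M = ≤-trans (≤-pred (subst (suc k ≤_) (+-comm (2 * m) 1) k<M)) (*-monoˡ-≤ m (s≤s (s≤s (z≤n {1}))))

lemma2p7 : (m : ℕ) → 1 ≤ m →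
    ((λ t → (cst 2 ⊕ X) ^^ t) ≍ (λ t → cst (2 ^ t) ⊛ (cst 1 ⊕ X) ^^ t) mod m)
    × ((λ t → (cst 2 ⊕ X) ^^ t ⊛ (cst 1 ⊕ X)) ≍ (λ t → (cst 2 ⊕ X) ^^ t) mod m)
    × ((λ t → (cst 1 ⊕ cst (2 ^ t) ⊛ X) ^^ m ⊛ (cst 1 ⊕ X)) ≍ (λ t → (cst 1 ⊕ cst (2 ^ t) ⊛ X) ^^ m) mod (m + 1))
    × ((λ t → RI (S2 t)) ≍ (λ t → cst 1 ⊕ cst (2 ^ t) ⊛ X ⊛ (cst 1 ⊕ X) ^^ t) mod m)
    × ((λ t → RI (S2 t) ^^ 3) ≍ (λ t → (cst 1 ⊕ cst (2 ^ t) ⊛ X) ^^ 2 ⊕ X ^^ 3 ⊛ (cst 2 ⊕ X) ^^ (3 * t)) mod m)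
    × ((λ t → RI (T3 t)) ≍ (λ t → (cst 1 ⊕ cst (2 ^ t) ⊛ X) ^^ 2 ⊕ X ^^ 2 ⊛ (cst 2 ⊕ X) ^^ (3 * t)) mod m)
    × ((λ t → RI (T3 t) ^^ m ⊛ (X ⊕ cst 1)) ≍ (λ t k → 2 ^ ((k + k / 2) * t)) mod (2 * m + 1))
    × ((λ t → RI (S2 t) ^^ (3 * m)) ≍ (λ t k → 2 ^ (k * t)) mod (2 * m + 1))
lemma2p7 m _ =
  ≋[]⇒≍ (pow-2+x-≋ m) ,
  ≋[]⇒≍ (pow-2+x-absorbs-1+x m) ,
  ≋[]⇒≍ (pow-1+2^tx-absorbs-1+x m) ,
  ≋[]⇒≍ (RI-S2-≋ m) ,
  ≋[]⇒≍ (RI-S2-cube-≋ m) ,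
  ≋[]⇒≍ (RI-T3-≋ m) ,
  ≋[]⇒≍ (RI-T3-pow-≋ m) ,
  ≋[]⇒≍ (RI-S2-pow-≋ m)
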